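{- Let $p,q$ be distinct odd primes and $e,f$ positive integers. If $p^eq^f$ is a weak Carmichael number, then $p^{de}q^{lf}$ is also a weak Carmichael number for all positive integers $d$ and $l$.
   Context: A composite positive integer $n$ is called a weak Carmichael number if $\sum_{1\le k\le n-1,\ \gcd(k,n)=1} k^{n-1}\equiv \varphi(n)\pmod{n}$, where $\varphi$ is Euler's totient function. -}

module Defs where

open import Data.Nat using (ℕ; suc; _∸_; _^_)
open import Data.Nat.GCD using (gcd)
open import Data.Nat.Primality using (Composite)
open import Data.List using (List; filter; map; length)
open import Data.Nat.ListAction using (sum)
open import Data.List.Base using (upTo)
open import Data.Nat.Properties using (_≟_)
open import Data.Integer using (ℤ; +_; _-_)
open import Data.Integer.Divisibility using () renaming (_∣_ to _∣ℤ_)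
open import Data.Product using (_×_)

range1 : ℕ → List ℕ
range1 m = map suc (upTo m)

coprimesUpTo : ℕ → ℕ → List ℕ
coprimesUpTo m n = filter (λ k → gcd k n ≟ 1) (range1 m)

φ : ℕ → ℕ
φ n = length (coprimesUpTo n n)

_≡_[mod_] : ℕ → ℕ → ℕ → Set
a ≡ b [mod n ] = (+ n) ∣ℤ ((+ a) - (+ b))

WeakCarmichael : ℕ → Set
WeakCarmichael n =
  Composite n × (sum (map (λ k → k ^ (n ∸ 1)) (coprimesUpTo (n ∸ 1) n)) ≡ φ n [mod n ])

-- Write n = p^E q^F and D = ∑_{k<n, (k,n)=1} k^(n-1) - φ(n). Inclusion-exclusion over the
-- multiples of p, q and pq, the periodicity of power sums modulo p^E, and the lifting
-- ∑_{k<p^E} k^m ≡ p^(E-1) ∑_{k<p} k^m (mod p^E), valid for odd p, give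
--   D ≡ p^(E-1) q^(F-1) ((q - q^(n-1)) ∑_{k<p} k^(n-1) + q - 1)  (mod p^E).
-- As ∑_{k<p} k^t is ≡ -1 or 0 (mod p) according as p - 1 divides t or not, p^E divides D iff
-- p ∣ q - 1 or p - 1 ∣ n - 1; with the same for q and the Chinese remainder theorem, n is weak
-- Carmichael iff both conditions hold. Modulo p - 1 we have p ≡ 1, so p - 1 ∣ n - 1 means
-- q^F ≡ 1, which persists when p^E q^F is replaced by p^(dE) q^(lF); likewise for q.

module Submission where

open import Defs
open import Level using (0ℓ)
open import Data.Empty using (⊥-elim)
open import Data.Product using (_×_; _,_; proj₂)
import Data.Product as Product
open import Data.Sum using (_⊎_; inj₁; inj₂)
import Data.Sum as Sum
open import Data.Nat.Primality using (Prime; prime⇒nonZero)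
open import Data.Integer.Tactic.RingSolver using (solve-∀)
open import Function.Bundles using (_⇔_; mk⇔; Equivalence)
open import Relation.Nullary using (¬_; Dec; yes; no)
open import Relation.Binary.Bundles using (Setoid)
import Relation.Binary.Reasoning.Setoid
open import Relation.Binary.PropositionalEquality

module ℕ where
  open import Data.Nat public
  open import Data.Nat.Properties public
  open import Data.Nat.Divisibility public

module ℤ where
  open import Data.Integer public
  open import Data.Integer.Properties public
  open import Data.Integer.Divisibility.Signed public

open ℕ using (ℕ; zero; suc; z≤n; s≤s)
open ℤ using (ℤ; +_; 0ℤ; 1ℤ)

module FiniteSums where
  open import Data.Integer using (_+_; _-_; _*_)
  open import Data.Integer.Divisibility.Signed using (_∣_)

  ∑ : ℕ → (ℕ → ℤ) → ℤ
  ∑ zero    f = 0ℤ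
  ∑ (suc n) f = ∑ n f + f n

  infixr 8 ∑
  syntax ∑ n (λ k → e) = ∑[ k < n ] e

  ∑-cong : ∀ n {f g : ℕ → ℤ} → (∀ {k} → k ℕ.< n → f k ≡ g k) → ∑ n f ≡ ∑ n g
  ∑-cong zero    f≡g = refl
  ∑-cong (suc n) f≡g = cong₂ _+_ (∑-cong n (λ k<n → f≡g (ℕ.m<n⇒m<1+n k<n))) (f≡g ℕ.≤-refl)

  ∑-distrib-+ : ∀ n f g → ∑[ k < n ] (f k + g k) ≡ ∑ n f + ∑ n g
  ∑-distrib-+ zero    f g = refl
  ∑-distrib-+ (suc n) f g rewrite ∑-distrib-+ n f g = rearrange (∑ n f) (∑ n g) (f n) (g n)
    where rearrange : ∀ a b c d → a + b + (c + d) ≡ a + c + (b + d)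
          rearrange = solve-∀

  ∑-distrib-sub : ∀ n f g → ∑[ k < n ] (f k - g k) ≡ ∑ n f - ∑ n g
  ∑-distrib-sub zero    f g = refl
  ∑-distrib-sub (suc n) f g rewrite ∑-distrib-sub n f g = rearrange (∑ n f) (∑ n g) (f n) (g n)
    where rearrange : ∀ a b c d → a - b + (c - d) ≡ a + c - (b + d)
          rearrange = solve-∀

  ∑-distribˡ-* : ∀ n c f → ∑[ k < n ] (c * f k) ≡ c * ∑ n f
  ∑-distribˡ-* zero    c f = sym (ℤ.*-zeroʳ c)
  ∑-distribˡ-* (suc n) c f rewrite ∑-distribˡ-* n c f = sym (ℤ.*-distribˡ-+ c (∑ n f) (f n))

  ∑-const : ∀ n c → ∑[ k < n ] c ≡ + n * c
  ∑-const zero    c = sym (ℤ.*-zeroˡ c)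
  ∑-const (suc n) c rewrite ∑-const n c = rearrange (+ n) c
    where rearrange : ∀ a c → a * c + c ≡ (1ℤ + a) * c
          rearrange = solve-∀

  ∑-zero : ∀ n → ∑[ k < n ] 0ℤ ≡ 0ℤ
  ∑-zero n = trans (∑-const n 0ℤ) (ℤ.*-zeroʳ (+ n))

  ∑-split : ∀ a b f → ∑ (a ℕ.+ b) f ≡ ∑ a f + ∑[ k < b ] f (a ℕ.+ k)
  ∑-split a zero    f rewrite ℕ.+-identityʳ a = sym (ℤ.+-identityʳ (∑ a f))
  ∑-split a (suc b) f rewrite ℕ.+-suc a b | ∑-split a b f = ℤ.+-assoc (∑ a f) _ _

  ∑-unfoldˡ : ∀ n f → ∑ (suc n) f ≡ f 0 + ∑[ k < n ] f (suc k)
  ∑-unfoldˡ n f = trans (∑-split 1 n f) (cong (_+ ∑[ k < n ] f (suc k)) (ℤ.+-identityˡ (f 0)))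

  ∑-blocks : ∀ c b f → ∑ (c ℕ.* b) f ≡ ∑[ j < c ] ∑[ i < b ] f (j ℕ.* b ℕ.+ i)
  ∑-blocks zero    b f = refl
  ∑-blocks (suc c) b f = begin
    ∑ (b ℕ.+ c ℕ.* b) f                                   ≡⟨ cong (λ N → ∑ N f) (ℕ.+-comm b (c ℕ.* b)) ⟩
    ∑ (c ℕ.* b ℕ.+ b) f                                   ≡⟨ ∑-split (c ℕ.* b) b f ⟩
    ∑ (c ℕ.* b) f + ∑[ i < b ] f (c ℕ.* b ℕ.+ i)          ≡⟨ cong (_+ ∑[ i < b ] f (c ℕ.* b ℕ.+ i)) (∑-blocks c b f) ⟩
    ∑[ j < c ] ∑[ i < b ] f (j ℕ.* b ℕ.+ i) + ∑[ i < b ] f (c ℕ.* b ℕ.+ i) ∎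
    where open ≡-Reasoning

  ∑-comm : ∀ a b (f : ℕ → ℕ → ℤ) → ∑[ i < a ] ∑[ j < b ] f i j ≡ ∑[ j < b ] ∑[ i < a ] f i j
  ∑-comm zero    b f = sym (∑-zero b)
  ∑-comm (suc a) b f rewrite ∑-comm a b f = sym (∑-distrib-+ b (λ j → ∑[ i < a ] f i j) (λ j → f a j))

  ∑-telescope : ∀ n (f : ℕ → ℤ) → ∑[ k < n ] (f (suc k) - f k) ≡ f n - f 0
  ∑-telescope zero    f = sym (ℤ.+-inverseʳ (f 0))
  ∑-telescope (suc n) f rewrite ∑-telescope n f = rearrange (f n) (f 0) (f (suc n))
    where rearrange : ∀ a b c → a - b + (c - a) ≡ c - b
          rearrange = solve-∀

  ∑-∣ : ∀ n {d} f → (∀ {k} → k ℕ.< n → d ∣ f k) → d ∣ ∑ n f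
  ∑-∣ zero    f d∣f = ℤ.divides 0ℤ refl
  ∑-∣ (suc n) f d∣f = ℤ.∣m∣n⇒∣m+n (∑-∣ n f (λ k<n → d∣f (ℕ.m<n⇒m<1+n k<n))) (d∣f ℕ.≤-refl)

open FiniteSums

module Congruences where
  open import Data.Integer using (_+_; _-_; _*_; -_; _^_)
  open import Data.Integer.Divisibility.Signed using (_∣_; divides)

  infix 4 _≈_[mod_]
  record _≈_[mod_] (a b d : ℤ) : Set where
    constructor mk≈
    field ∣-difference : d ∣ a - b
  open _≈_[mod_] public

  ≈-refl : ∀ {a d} → a ≈ a [mod d ]
  ≈-refl {a} = mk≈ (subst (_ ∣_) (sym (ℤ.+-inverseʳ a)) (divides 0ℤ refl))

  ≈-reflexive : ∀ {a b d} → a ≡ b → a ≈ b [mod d ]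
  ≈-reflexive refl = ≈-refl

  ≈-sym : ∀ {a b d} → a ≈ b [mod d ] → b ≈ a [mod d ]
  ≈-sym {a} {b} (mk≈ d∣a-b) = mk≈ (subst (_ ∣_) (rearrange a b) (ℤ.∣m⇒∣-m d∣a-b))
    where rearrange : ∀ a b → - (a - b) ≡ b - a
          rearrange = solve-∀

  ≈-trans : ∀ {a b c d} → a ≈ b [mod d ] → b ≈ c [mod d ] → a ≈ c [mod d ]
  ≈-trans {a} {b} {c} (mk≈ d∣a-b) (mk≈ d∣b-c) = mk≈ (subst (_ ∣_) (rearrange a b c) (ℤ.∣m∣n⇒∣m+n d∣a-b d∣b-c))
    where rearrange : ∀ a b c → (a - b) + (b - c) ≡ a - c
          rearrange = solve-∀

  ≈-setoid : ℤ → Setoid 0ℓ 0ℓ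
  ≈-setoid d = record
    { Carrier = ℤ
    ; _≈_ = λ a b → a ≈ b [mod d ]
    ; isEquivalence = record { refl = ≈-refl ; sym = ≈-sym ; trans = ≈-trans }
    }

  module ≈-Reasoning (d : ℤ) = Relation.Binary.Reasoning.Setoid (≈-setoid d)

  ∣⇒≈0 : ∀ {a d} → d ∣ a → a ≈ 0ℤ [mod d ]
  ∣⇒≈0 {a} d∣a = mk≈ (subst (_ ∣_) (sym (ℤ.+-identityʳ a)) d∣a)

  ≈0⇒∣ : ∀ {a d} → a ≈ 0ℤ [mod d ] → d ∣ a
  ≈0⇒∣ {a} (mk≈ d∣a-0) = subst (_ ∣_) (ℤ.+-identityʳ a) d∣a-0

  +-cong : ∀ {a b c e d} → a ≈ b [mod d ] → c ≈ e [mod d ] → a + c ≈ b + e [mod d ]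
  +-cong {a} {b} {c} {e} (mk≈ h₁) (mk≈ h₂) = mk≈ (subst (_ ∣_) (rearrange a b c e) (ℤ.∣m∣n⇒∣m+n h₁ h₂))
    where rearrange : ∀ a b c e → (a - b) + (c - e) ≡ (a + c) - (b + e)
          rearrange = solve-∀

  sub-cong : ∀ {a b c e d} → a ≈ b [mod d ] → c ≈ e [mod d ] → a - c ≈ b - e [mod d ]
  sub-cong {a} {b} {c} {e} (mk≈ h₁) (mk≈ h₂) = mk≈ (subst (_ ∣_) (rearrange a b c e) (ℤ.∣m∣n⇒∣m-n h₁ h₂))
    where rearrange : ∀ a b c e → (a - b) - (c - e) ≡ (a - c) - (b - e)
          rearrange = solve-∀

  *-cong : ∀ {a b c e d} → a ≈ b [mod d ] → c ≈ e [mod d ] → a * c ≈ b * e [mod d ]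
  *-cong {a} {b} {c} {e} (mk≈ h₁) (mk≈ h₂) =
    mk≈ (subst (_ ∣_) (rearrange a b c e) (ℤ.∣m∣n⇒∣m+n (ℤ.∣n⇒∣m*n c h₁) (ℤ.∣n⇒∣m*n b h₂)))
    where rearrange : ∀ a b c e → c * (a - b) + b * (c - e) ≡ a * c - b * e
          rearrange = solve-∀

  *-congˡ : ∀ {a b d} c → a ≈ b [mod d ] → c * a ≈ c * b [mod d ]
  *-congˡ c = *-cong (≈-refl {c})

  ^-cong : ∀ {a b d} m → a ≈ b [mod d ] → a ^ m ≈ b ^ m [mod d ]
  ^-cong zero    a≈b = ≈-refl
  ^-cong (suc m) a≈b = *-cong a≈b (^-cong m a≈b)

  ∑-cong-mod : ∀ n {d} f g → (∀ {k} → k ℕ.< n → f k ≈ g k [mod d ]) → ∑ n f ≈ ∑ n g [mod d ]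
  ∑-cong-mod n f g f≈g =
    mk≈ (subst (_ ∣_) (∑-distrib-sub n f g) (∑-∣ n (λ k → f k - g k) (λ k<n → ∣-difference (f≈g k<n))))

  ≈-weaken : ∀ {a b c d} → c ∣ d → a ≈ b [mod d ] → a ≈ b [mod c ]
  ≈-weaken c∣d (mk≈ d∣a-b) = mk≈ (ℤ.∣-trans c∣d d∣a-b)

  scale-cong : ∀ {a b d} c → a ≈ b [mod d ] → c * a ≈ c * b [mod c * d ]
  scale-cong {a} {b} {d} c (mk≈ (divides t a-b≡td)) =
    mk≈ (divides t (trans (factor c a b) (trans (cong (c *_) a-b≡td) (reassociate c t d))))
    where factor : ∀ c a b → c * a - c * b ≡ c * (a - b)
          factor = solve-∀
          reassociate : ∀ c t d → c * (t * d) ≡ t * (c * d)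
          reassociate = solve-∀

open Congruences

module Arithmetic where
  open import Data.Integer using (_+_; _-_; _*_; _^_)
  open import Data.Integer.Divisibility.Signed using (_∣_; ∣ᵤ⇒∣; ∣⇒∣ᵤ)
  open import Data.Nat.Primality using (euclidsLemma)

  pos-^ : ∀ a m → + (a ℕ.^ m) ≡ (+ a) ^ m
  pos-^ a zero    = refl
  pos-^ a (suc m) = trans (ℤ.pos-* a (a ℕ.^ m)) (cong (+ a *_) (pos-^ a m))

  pos-∸ : ∀ {m n} → n ℕ.≤ m → + (m ℕ.∸ n) ≡ + m - + n
  pos-∸ {m} {n} n≤m = trans (sym (ℤ.⊖-≥ n≤m)) (sym (ℤ.m-n≡m⊖n m n))

  0^n≡0 : ∀ {n} → 0 ℕ.< n → (+ 0) ^ n ≡ 0ℤ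
  0^n≡0 {suc n} _ = refl

  pos-suc : ∀ a → + suc a ≡ + a + 1ℤ
  pos-suc a = trans (cong +_ (ℕ.+-comm 1 a)) (ℤ.pos-+ a 1)

  euclidsLemma-∤ : ∀ {p} → Prime p → ∀ {a b} → ¬ (+ p ∣ a) → + p ∣ a * b → + p ∣ b
  euclidsLemma-∤ pp {a} {b} p∤a p∣ab with euclidsLemma ℤ.∣ a ∣ ℤ.∣ b ∣ pp (subst (_ ℕ.∣_) (ℤ.abs-* a b) (∣⇒∣ᵤ p∣ab))
  ... | inj₁ p∣a = ⊥-elim (p∤a (∣ᵤ⇒∣ p∣a))
  ... | inj₂ p∣b = ∣ᵤ⇒∣ p∣b

  pos-^*^ : ∀ a b c d → + (a ℕ.^ b ℕ.* c ℕ.^ d) ≡ (+ a) ^ b * (+ c) ^ d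
  pos-^*^ a b c d = trans (ℤ.pos-* (a ℕ.^ b) (c ℕ.^ d)) (cong₂ _*_ (pos-^ a b) (pos-^ c d))

  ^-distribʳ-* : ∀ a b m → (a * b) ^ m ≡ a ^ m * b ^ m
  ^-distribʳ-* a b zero    = refl
  ^-distribʳ-* a b (suc m) rewrite ^-distribʳ-* a b m = interchange a b (a ^ m) (b ^ m)
    where interchange : ∀ a b x y → a * b * (x * y) ≡ a * x * (b * y)
          interchange = solve-∀

  ∣⇒^∣^ : ∀ {a b} → a ∣ b → ∀ k → a ^ k ∣ b ^ k
  ∣⇒^∣^ a∣b zero    = ℤ.∣-refl
  ∣⇒^∣^ {a} {b} a∣b (suc k) = ℤ.∣-trans (ℤ.*-monoˡ-∣ (a ^ k) a∣b) (ℤ.*-monoʳ-∣ b (∣⇒^∣^ a∣b k))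

  ≤⇒^∣^ : ∀ a {m k} → m ℕ.≤ k → a ^ m ∣ a ^ k
  ≤⇒^∣^ a {m} {k} m≤k = ℤ.divides (a ^ (k ℕ.∸ m)) (begin
    a ^ k                    ≡⟨ cong (a ^_) (ℕ.m+[n∸m]≡n m≤k) ⟨
    a ^ (m ℕ.+ (k ℕ.∸ m))    ≡⟨ ℤ.^-distribˡ-+-* a m (k ℕ.∸ m) ⟩
    a ^ m * a ^ (k ℕ.∸ m)    ≡⟨ ℤ.*-comm (a ^ m) _ ⟩
    a ^ (k ℕ.∸ m) * a ^ m    ∎)
    where open ≡-Reasoning

  n<m^n : ∀ {m} → 2 ℕ.≤ m → ∀ n → n ℕ.< m ℕ.^ n
  n<m^n 2≤m zero    = s≤s z≤n
  n<m^n {m} 2≤m (suc n) = ℕ.≤-trans (ℕ.+-mono-≤ (ℕ.m<n⇒0<n n<mⁿ) n<mⁿ)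
    (ℕ.≤-trans (ℕ.≤-reflexive (cong (m ℕ.^ n ℕ.+_) (sym (ℕ.+-identityʳ (m ℕ.^ n))))) (ℕ.*-monoˡ-≤ (m ℕ.^ n) 2≤m))
    where n<mⁿ : n ℕ.< m ℕ.^ n
          n<mⁿ = n<m^n 2≤m n


open Arithmetic

module Binomial where
  open import Data.Integer using (_+_; _-_; _*_; _^_)
  open import Data.Nat.Combinatorics using (_C_; nC1≡n; k>n⇒nCk≡0; nCk+nC[k+1]≡[n+1]C[k+1])
  open import Data.Nat.Primality using (euclidsLemma)
  import Data.Nat.Tactic.RingSolver as ℕ-Solver

  [k+1]*[n+1]C[k+1]≡[n+1]*nCk : ∀ n k → suc k ℕ.* (suc n C suc k) ≡ suc n ℕ.* (n C k)
  [k+1]*[n+1]C[k+1]≡[n+1]*nCk zero    zero    = refl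
  [k+1]*[n+1]C[k+1]≡[n+1]*nCk zero    (suc k) = ℕ.*-zeroʳ (suc (suc k))
  [k+1]*[n+1]C[k+1]≡[n+1]*nCk (suc n) zero    =
    trans (ℕ.*-identityˡ _) (trans (nC1≡n (suc (suc n))) (sym (ℕ.*-identityʳ _)))
  [k+1]*[n+1]C[k+1]≡[n+1]*nCk (suc n) (suc k) = begin
    suc (suc k) ℕ.* (suc (suc n) C suc (suc k))
      ≡⟨ cong (suc (suc k) ℕ.*_) (sym (nCk+nC[k+1]≡[n+1]C[k+1] (suc n) (suc k))) ⟩
    suc (suc k) ℕ.* (a ℕ.+ b)
      ≡⟨ expand k a b ⟩
    a ℕ.+ suc k ℕ.* a ℕ.+ suc (suc k) ℕ.* b
      ≡⟨ cong₂ (λ u v → a ℕ.+ u ℕ.+ v) ([k+1]*[n+1]C[k+1]≡[n+1]*nCk n k) ([k+1]*[n+1]C[k+1]≡[n+1]*nCk n (suc k)) ⟩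
    a ℕ.+ suc n ℕ.* (n C k) ℕ.+ suc n ℕ.* (n C suc k)
      ≡⟨ factor a (suc n) (n C k) (n C suc k) ⟩
    a ℕ.+ suc n ℕ.* (n C k ℕ.+ n C suc k)
      ≡⟨ cong (λ c → a ℕ.+ suc n ℕ.* c) (nCk+nC[k+1]≡[n+1]C[k+1] n k) ⟩
    suc (suc n) ℕ.* a ∎
    where
    open ≡-Reasoning
    a b : ℕ
    a = suc n C suc k
    b = suc n C suc (suc k)
    expand : ∀ k a b → (2 ℕ.+ k) ℕ.* (a ℕ.+ b) ≡ a ℕ.+ (1 ℕ.+ k) ℕ.* a ℕ.+ (2 ℕ.+ k) ℕ.* b
    expand = ℕ-Solver.solve-∀
    factor : ∀ a m u v → a ℕ.+ m ℕ.* u ℕ.+ m ℕ.* v ≡ a ℕ.+ m ℕ.* (u ℕ.+ v)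
    factor = ℕ-Solver.solve-∀

  p∣pCk : ∀ {p k} → Prime p → 0 ℕ.< k → k ℕ.< p → p ℕ.∣ p C k
  p∣pCk {suc p′} {suc k′} pp _ k<p
    with euclidsLemma (suc k′) (suc p′ C suc k′) pp
           (ℕ.divides (p′ C k′) (trans ([k+1]*[n+1]C[k+1]≡[n+1]*nCk p′ k′) (ℕ.*-comm (suc p′) (p′ C k′))))
  ... | inj₁ p∣k  = ⊥-elim (ℕ.>⇒∤ k<p p∣k)
  ... | inj₂ p∣pCk = p∣pCk

  binomialTheorem : ∀ x n → (x + 1ℤ) ^ n ≡ ∑[ j < suc n ] (+ (n C j) * x ^ j)
  binomialTheorem x zero    = refl
  binomialTheorem x (suc n) = sym (begin
    ∑[ j < suc (suc n) ] (+ (suc n C j) * x ^ j)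
      ≡⟨ ∑-unfoldˡ (suc n) _ ⟩
    1ℤ * 1ℤ + ∑[ j < suc n ] (+ (suc n C suc j) * x ^ suc j)
      ≡⟨ cong (λ s → 1ℤ * 1ℤ + s) (∑-cong (suc n) (λ {j} _ → pascal j)) ⟩
    1ℤ * 1ℤ + ∑[ j < suc n ] (x * (+ (n C j) * x ^ j) + + (n C suc j) * x ^ suc j)
      ≡⟨ cong (λ s → 1ℤ * 1ℤ + s) (∑-distrib-+ (suc n) _ _) ⟩
    1ℤ * 1ℤ + (∑[ j < suc n ] (x * (+ (n C j) * x ^ j)) + ∑[ j < suc n ] (+ (n C suc j) * x ^ suc j))
      ≡⟨ cong₂ (λ u v → 1ℤ * 1ℤ + (u + v)) (∑-distribˡ-* (suc n) x _) shifted ⟩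
    1ℤ * 1ℤ + (x * T + (T - 1ℤ))
      ≡⟨ regroup x T ⟩
    (x + 1ℤ) * T
      ≡⟨ cong ((x + 1ℤ) *_) (sym (binomialTheorem x n)) ⟩
    (x + 1ℤ) ^ suc n ∎)
    where
    open ≡-Reasoning
    T : ℤ
    T = ∑[ j < suc n ] (+ (n C j) * x ^ j)
    pascal : ∀ j → + (suc n C suc j) * x ^ suc j ≡ x * (+ (n C j) * x ^ j) + + (n C suc j) * x ^ suc j
    pascal j rewrite sym (nCk+nC[k+1]≡[n+1]C[k+1] n j) | ℤ.pos-+ (n C j) (n C suc j) =
      distrib (+ (n C j)) (+ (n C suc j)) x (x ^ j)
      where distrib : ∀ a b x y → (a + b) * (x * y) ≡ x * (a * y) + b * (x * y)
            distrib = solve-∀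
    shifted : ∑[ j < suc n ] (+ (n C suc j) * x ^ suc j) ≡ T - 1ℤ
    shifted = begin
      ∑[ j < suc n ] (+ (n C suc j) * x ^ suc j)
        ≡⟨ add-sub-1 _ ⟩
      1ℤ * 1ℤ + ∑[ j < suc n ] (+ (n C suc j) * x ^ suc j) - 1ℤ
        ≡⟨ cong (_- 1ℤ) (sym (∑-unfoldˡ (suc n) (λ j → + (n C j) * x ^ j))) ⟩
      T + + (n C suc n) * x ^ suc n - 1ℤ
        ≡⟨ cong (λ c → T + + c * x ^ suc n - 1ℤ) (k>n⇒nCk≡0 (ℕ.n<1+n n)) ⟩
      T + 0ℤ * x ^ suc n - 1ℤ
        ≡⟨ cong (_- 1ℤ) (ℤ.+-identityʳ T) ⟩
      T - 1ℤ ∎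
      where add-sub-1 : ∀ a → a ≡ 1ℤ * 1ℤ + a - 1ℤ
            add-sub-1 = solve-∀
    regroup : ∀ x T → 1ℤ * 1ℤ + (x * T + (T - 1ℤ)) ≡ (x + 1ℤ) * T
    regroup = solve-∀

open Binomial

module Fermat where
  open import Data.Integer using (_+_; _-_; _*_; _^_)
  open import Data.Integer.Divisibility.Signed using (_∣_; ∣m⇒∣m*n; ∣ᵤ⇒∣; ∣⇒∣ᵤ)
  open import Data.Nat.Combinatorics using (_C_; nCn≡1)

  [x+1]^p≈x^p+1 : ∀ {p} → Prime p → ∀ x → (x + 1ℤ) ^ p ≈ x ^ p + 1ℤ [mod + p ]
  [x+1]^p≈x^p+1 {suc p′} pp x = begin
    (x + 1ℤ) ^ p                        ≡⟨ binomialTheorem x p ⟩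
    ∑ p f + f p                         ≡⟨ cong (_+ f p) (∑-unfoldˡ p′ f) ⟩
    f 0 + ∑[ j < p′ ] f (suc j) + f p   ≈⟨ +-cong (+-cong (≈-refl {f 0}) (∑-cong-mod p′ _ _ p∣middle)) (≈-refl {f p}) ⟩
    f 0 + ∑[ j < p′ ] 0ℤ + f p          ≡⟨ cong₂ (λ s c → f 0 + s + + c * x ^ p) (∑-zero p′) (nCn≡1 p) ⟩
    1ℤ * 1ℤ + 0ℤ + 1ℤ * x ^ p           ≡⟨ simplify (x ^ p) ⟩
    x ^ p + 1ℤ                          ∎
    where
    p : ℕ
    p = suc p′
    open ≈-Reasoning (+ p)
    f : ℕ → ℤ
    f j = + (p C j) * x ^ j
    p∣middle : ∀ {j} → j ℕ.< p′ → f (suc j) ≈ 0ℤ [mod + p ]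
    p∣middle {j} j<p′ = ∣⇒≈0 (∣m⇒∣m*n (x ^ suc j) (∣ᵤ⇒∣ {i = + (p C suc j)} (p∣pCk pp (s≤s z≤n) (s≤s j<p′))))
    simplify : ∀ y → 1ℤ * 1ℤ + 0ℤ + 1ℤ * y ≡ y + 1ℤ
    simplify = solve-∀

  fermat : ∀ {p} → Prime p → ∀ a → (+ a) ^ p ≈ + a [mod + p ]
  fermat {suc p′} pp zero    = ≈-refl
  fermat {p}      pp (suc a) = begin
    (+ suc a) ^ p    ≡⟨ cong (_^ p) (pos-suc a) ⟩
    (+ a + 1ℤ) ^ p   ≈⟨ [x+1]^p≈x^p+1 pp (+ a) ⟩
    (+ a) ^ p + 1ℤ   ≈⟨ +-cong (fermat pp a) (≈-refl {1ℤ}) ⟩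
    + a + 1ℤ         ≡⟨ pos-suc a ⟨
    + suc a          ∎
    where open ≈-Reasoning (+ p)

  fermat-coprime : ∀ {p} → Prime p → ∀ {a} → ¬ (p ℕ.∣ a) → (+ a) ^ (p ℕ.∸ 1) ≈ 1ℤ [mod + p ]
  fermat-coprime {suc p′} pp {a} p∤a =
    mk≈ (euclidsLemma-∤ pp {+ a} (λ p∣a → p∤a (∣⇒∣ᵤ p∣a))
          (subst (+ suc p′ ∣_) (factorise (+ a) ((+ a) ^ p′)) (∣-difference (fermat pp a))))
    where factorise : ∀ a y → a * y - a ≡ a * (y - 1ℤ)
          factorise = solve-∀

  fermat-∣ : ∀ {p} → Prime p → ∀ {a t} → ¬ (p ℕ.∣ a) → (p ℕ.∸ 1) ℕ.∣ t → (+ a) ^ t ≈ 1ℤ [mod + p ]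
  fermat-∣ {p} pp {a} p∤a (ℕ.divides s refl) = begin
    (+ a) ^ (s ℕ.* (p ℕ.∸ 1))    ≡⟨ cong ((+ a) ^_) (ℕ.*-comm s (p ℕ.∸ 1)) ⟩
    (+ a) ^ ((p ℕ.∸ 1) ℕ.* s)    ≡⟨ ℤ.^-*-assoc (+ a) (p ℕ.∸ 1) s ⟨
    ((+ a) ^ (p ℕ.∸ 1)) ^ s      ≈⟨ ^-cong s (fermat-coprime pp p∤a) ⟩
    1ℤ ^ s                       ≡⟨ ℤ.^-zeroˡ s ⟩
    1ℤ                           ∎
    where open ≈-Reasoning (+ p)

open Fermat


module PowerSums where
  open import Data.Integer using (_+_; _-_; _*_; _^_)
  open import Data.Integer.Divisibility.Signed using (_∣_; ∣-refl; ∣m⇒∣m*n; ∣n⇒∣m*n; ∣m+n∣m⇒∣n)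
  open import Data.Nat.Combinatorics using (_C_; nCn≡1; nC1≡n; nCk≡nC[n∸k])
  open import Data.Nat.DivMod using (_%_; _/_; m≡m%n+[m/n]*n; m%n<n)
  open import Data.Nat.Induction using (<-rec)

  -- Since 0 ^ 0 = 1, powerSum N 0 = N.
  powerSum : ℕ → ℕ → ℤ
  powerSum N t = ∑[ k < N ] (+ k) ^ t

  ^-difference : ∀ x n → (x + 1ℤ) ^ n - x ^ n ≡ ∑[ j < n ] (+ (n C j) * x ^ j)
  ^-difference x n = begin
    (x + 1ℤ) ^ n - x ^ n                                        ≡⟨ cong (_- x ^ n) (binomialTheorem x n) ⟩
    T + + (n C n) * x ^ n - x ^ n  ≡⟨ cong (λ c → T + + c * x ^ n - x ^ n) (nCn≡1 n) ⟩
    T + 1ℤ * x ^ n - x ^ n         ≡⟨ cancel T (x ^ n) ⟩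
    T                              ∎
    where open ≡-Reasoning
          T : ℤ
          T = ∑[ j < n ] (+ (n C j) * x ^ j)
          cancel : ∀ a b → a + 1ℤ * b - b ≡ a
          cancel = solve-∀

  ∑C*powerSum : ∀ N r → ∑[ j < suc r ] (+ (suc r C j) * powerSum N j) ≡ (+ N) ^ suc r
  ∑C*powerSum N r = begin
    ∑[ j < suc r ] (+ (suc r C j) * powerSum N j)
      ≡⟨ ∑-cong (suc r) (λ {j} _ → ∑-distribˡ-* N (+ (suc r C j)) (λ k → (+ k) ^ j)) ⟨
    ∑[ j < suc r ] ∑[ k < N ] (+ (suc r C j) * (+ k) ^ j)
      ≡⟨ ∑-comm N (suc r) (λ k j → + (suc r C j) * (+ k) ^ j) ⟨
    ∑[ k < N ] ∑[ j < suc r ] (+ (suc r C j) * (+ k) ^ j)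
      ≡⟨ ∑-cong N (λ {k} _ → difference k) ⟨
    ∑[ k < N ] ((+ suc k) ^ suc r - (+ k) ^ suc r)
      ≡⟨ ∑-telescope N (λ k → (+ k) ^ suc r) ⟩
    (+ N) ^ suc r - 0ℤ
      ≡⟨ ℤ.+-identityʳ _ ⟩
    (+ N) ^ suc r ∎
    where
    open ≡-Reasoning
    difference : ∀ k → (+ suc k) ^ suc r - (+ k) ^ suc r ≡ ∑[ j < suc r ] (+ (suc r C j) * (+ k) ^ j)
    difference k = trans (cong (λ y → y ^ suc r - (+ k) ^ suc r) (pos-suc k)) (^-difference (+ k) (suc r))

  -- Strong induction on r: ∑C*powerSum isolates (r + 1) · powerSum p r, and p ∤ r + 1.
  p∣powerSum : ∀ {p} → Prime p → ∀ r → suc r ℕ.< p → + p ∣ powerSum p r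
  p∣powerSum {p} pp = <-rec (λ r → suc r ℕ.< p → + p ∣ powerSum p r) step
    where
    step : ∀ r → (∀ {j} → j ℕ.< r → suc j ℕ.< p → + p ∣ powerSum p j) → suc r ℕ.< p → + p ∣ powerSum p r
    step r ih r+1<p = euclidsLemma-∤ pp p∤r+1 p∣[r+1]*Sᵣ
      where
      p∤r+1 : ¬ (+ p ∣ + suc r)
      p∤r+1 p∣r+1 = ℕ.>⇒∤ r+1<p (ℤ.∣⇒∣ᵤ p∣r+1)
      [r+1]C[r]≡r+1 : suc r C r ≡ suc r
      [r+1]C[r]≡r+1 = trans (nCk≡nC[n∸k] (ℕ.n≤1+n r)) (trans (cong (suc r C_) (ℕ.m+n∸n≡m 1 r)) (nC1≡n (suc r)))
      identity : ∑[ j < r ] (+ (suc r C j) * powerSum p j) + + suc r * powerSum p r ≡ (+ p) ^ suc r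
      identity = trans (cong (λ c → ∑[ j < r ] (+ (suc r C j) * powerSum p j) + + c * powerSum p r) (sym [r+1]C[r]≡r+1))
                       (∑C*powerSum p r)
      p∣[r+1]*Sᵣ : + p ∣ + suc r * powerSum p r
      p∣[r+1]*Sᵣ = ∣m+n∣m⇒∣n (subst (+ p ∣_) (sym identity) (∣m⇒∣m*n ((+ p) ^ r) ∣-refl))
        (∑-∣ r (λ j → + (suc r C j) * powerSum p j) (λ {j} j<r → ∣n⇒∣m*n (+ (suc r C j)) (ih j<r (ℕ.<-trans (s≤s j<r) r+1<p))))

  powerSum-vanishes : ∀ {p t} → Prime p → ¬ ((p ℕ.∸ 1) ℕ.∣ t) → + p ∣ powerSum p t
  powerSum-vanishes {suc (suc p″)} {t} pp p-1∤t = ≈0⇒∣ (begin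
    powerSum p t   ≈⟨ ∑-cong-mod p _ _ reduce ⟩
    powerSum p r   ≈⟨ ∣⇒≈0 (p∣powerSum pp r (s≤s (m%n<n t (suc p″)))) ⟩
    0ℤ             ∎)
    where
    p : ℕ
    p = suc (suc p″)
    open ≈-Reasoning (+ p)
    r : ℕ
    r = t % suc p″
    t≡r+[t/[p-1]]*[p-1] : t ≡ r ℕ.+ t / suc p″ ℕ.* suc p″
    t≡r+[t/[p-1]]*[p-1] = m≡m%n+[m/n]*n t (suc p″)
    0<r : 0 ℕ.< r
    0<r = ℕ.n≢0⇒n>0 (λ r≡0 → p-1∤t (ℕ.m%n≡0⇒n∣m t (suc p″) r≡0))
    0<t : 0 ℕ.< t
    0<t = ℕ.≤-trans 0<r (subst (r ℕ.≤_) (sym t≡r+[t/[p-1]]*[p-1]) (ℕ.m≤m+n r _))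
    reduce : ∀ {k} → k ℕ.< p → (+ k) ^ t ≈ (+ k) ^ r [mod + p ]
    reduce {zero}  _   = ≈-reflexive (trans (0^n≡0 0<t) (sym (0^n≡0 0<r)))
    reduce {suc k} k<p = begin
      (+ suc k) ^ t                                          ≡⟨ cong ((+ suc k) ^_) t≡r+[t/[p-1]]*[p-1] ⟩
      (+ suc k) ^ (r ℕ.+ t / suc p″ ℕ.* suc p″)              ≡⟨ ℤ.^-distribˡ-+-* (+ suc k) r _ ⟩
      (+ suc k) ^ r * (+ suc k) ^ (t / suc p″ ℕ.* suc p″)    ≈⟨ *-congˡ ((+ suc k) ^ r) fermat-factor ⟩
      (+ suc k) ^ r * 1ℤ                                     ≡⟨ ℤ.*-identityʳ _ ⟩
      (+ suc k) ^ r                                          ∎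
      where fermat-factor : (+ suc k) ^ (t / suc p″ ℕ.* suc p″) ≈ 1ℤ [mod + p ]
            fermat-factor = fermat-∣ pp (ℕ.>⇒∤ k<p) (ℕ.divides (t / suc p″) refl)

  powerSum≈p-1 : ∀ {p t} → Prime p → 0 ℕ.< t → (p ℕ.∸ 1) ℕ.∣ t → powerSum p t ≈ + (p ℕ.∸ 1) [mod + p ]
  powerSum≈p-1 {suc p′} {t} pp 0<t p-1∣t = begin
    powerSum (suc p′) t                   ≡⟨ ∑-unfoldˡ p′ _ ⟩
    (+ 0) ^ t + ∑[ k < p′ ] (+ suc k) ^ t  ≈⟨ +-cong (≈-reflexive (0^n≡0 0<t)) (∑-cong-mod p′ _ _ unit) ⟩
    0ℤ + ∑[ k < p′ ] 1ℤ                    ≡⟨ ℤ.+-identityˡ _ ⟩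
    ∑[ k < p′ ] 1ℤ                         ≡⟨ ∑-const p′ 1ℤ ⟩
    + p′ * 1ℤ                              ≡⟨ ℤ.*-identityʳ (+ p′) ⟩
    + p′                                   ∎
    where
    open ≈-Reasoning (+ suc p′)
    unit : ∀ {k} → k ℕ.< p′ → (+ suc k) ^ t ≈ 1ℤ [mod + suc p′ ]
    unit k<p′ = fermat-∣ pp (ℕ.>⇒∤ (s≤s k<p′)) p-1∣t

open PowerSums

module PowerSumsOverBlocks where
  open import Data.Integer using (_+_; _-_; _*_; _^_)
  open import Data.Integer.Divisibility.Signed using (_∣_; divides; ∣-refl; ∣m⇒∣m*n)
  open import Data.Nat.Primality using (prime⇒nonTrivial)

  ^-linearisation : ∀ m i x → (i + x) ^ suc m ≈ i ^ suc m + (+ suc m * x) * i ^ m [mod x * x ]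
  ^-linearisation zero    i x = ≈-reflexive (expand i x)
    where expand : ∀ i x → (i + x) * 1ℤ ≡ i * 1ℤ + (1ℤ * x) * 1ℤ
          expand = solve-∀
  ^-linearisation (suc m) i x = begin
    (i + x) * (i + x) ^ suc m                           ≈⟨ *-congˡ (i + x) (^-linearisation m i x) ⟩
    (i + x) * (i ^ suc m + (+ suc m * x) * i ^ m)       ≈⟨ mk≈ (divides (+ suc m * i ^ m) (quadratic-remainder i x (i ^ m) (+ suc m))) ⟩
    i * i ^ suc m + ((+ suc m + 1ℤ) * x) * i ^ suc m     ≡⟨ cong (λ c → i * i ^ suc m + (c * x) * i ^ suc m) (pos-suc (suc m)) ⟨
    i ^ suc (suc m) + (+ suc (suc m) * x) * i ^ suc m   ∎
    where
    open ≈-Reasoning (x * x)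
    quadratic-remainder : ∀ i x y c →
      (i + x) * (i * y + (c * x) * y) - (i * (i * y) + ((c + 1ℤ) * x) * (i * y)) ≡ (c * y) * (x * x)
    quadratic-remainder = solve-∀

  2*∑k≡n*[n-1] : ∀ n → + 2 * ∑[ k < n ] (+ k) ≡ + n * (+ n - 1ℤ)
  2*∑k≡n*[n-1] zero    = refl
  2*∑k≡n*[n-1] (suc n) = begin
    + 2 * (∑[ k < n ] (+ k) + + n)           ≡⟨ ℤ.*-distribˡ-+ (+ 2) (∑[ k < n ] (+ k)) (+ n) ⟩
    + 2 * ∑[ k < n ] (+ k) + + 2 * + n       ≡⟨ cong (_+ + 2 * + n) (2*∑k≡n*[n-1] n) ⟩
    + n * (+ n - 1ℤ) + + 2 * + n             ≡⟨ step (+ n) ⟩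
    (+ n + 1ℤ) * (+ n + 1ℤ - 1ℤ)             ≡⟨ cong (λ m → m * (m - 1ℤ)) (pos-suc n) ⟨
    + suc n * (+ suc n - 1ℤ)                 ∎
    where open ≡-Reasoning
          step : ∀ n → n * (n - 1ℤ) + + 2 * n ≡ (n + 1ℤ) * (n + 1ℤ - 1ℤ)
          step = solve-∀

  p∣∑k : ∀ {p} → Prime p → ¬ (2 ℕ.∣ p) → + p ∣ ∑[ k < p ] (+ k)
  p∣∑k {p} pp 2∤p = euclidsLemma-∤ pp p∤2 (subst (+ p ∣_) (sym (2*∑k≡n*[n-1] p)) (∣m⇒∣m*n (+ p - 1ℤ) ∣-refl))
    where
    p∤2 : ¬ (+ p ∣ + 2)
    p∤2 p∣2 = 2∤p (subst (2 ℕ.∣_) 2≡p ℕ.∣-refl)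
      where 2≡p : 2 ≡ p
            2≡p = ℕ.≤-antisym (ℕ.nonTrivial⇒n>1 p {{prime⇒nonTrivial pp}}) (ℕ.∣⇒≤ (ℤ.∣⇒∣ᵤ p∣2))

  powerSum-blocks : ∀ c M t →
    powerSum (c ℕ.* M) (suc t) ≈ + c * powerSum M (suc t) + (+ suc t * + M * powerSum M t) * ∑[ j < c ] (+ j) [mod + M * + M ]
  powerSum-blocks c M t = begin
    powerSum (c ℕ.* M) (suc t)
      ≡⟨ ∑-blocks c M (λ k → (+ k) ^ suc t) ⟩
    ∑[ j < c ] ∑[ i < M ] (+ (j ℕ.* M ℕ.+ i)) ^ suc t
      ≈⟨ ∑-cong-mod c _ _ (λ {j} _ → ∑-cong-mod M _ _ (λ {i} _ → linear j i)) ⟩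
    ∑[ j < c ] ∑[ i < M ] ((+ i) ^ suc t + (+ suc t * (+ j * + M)) * (+ i) ^ t)
      ≡⟨ ∑-cong c (λ {j} _ → inner j) ⟩
    ∑[ j < c ] (U + L * + j)
      ≡⟨ outer ⟩
    + c * U + L * ∑[ j < c ] (+ j) ∎
    where
    open ≈-Reasoning (+ M * + M)
    U V L : ℤ
    U = powerSum M (suc t)
    V = powerSum M t
    L = + suc t * + M * V
    linear : ∀ j i → (+ (j ℕ.* M ℕ.+ i)) ^ suc t ≈ (+ i) ^ suc t + (+ suc t * (+ j * + M)) * (+ i) ^ t [mod + M * + M ]
    linear j i = subst (λ y → y ^ suc t ≈ (+ i) ^ suc t + (+ suc t * (+ j * + M)) * (+ i) ^ t [mod + M * + M ]) cast
      (≈-weaken (divides (+ j * + j) (square (+ j) (+ M))) (^-linearisation t (+ i) (+ j * + M)))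
      where
      cast : + i + + j * + M ≡ + (j ℕ.* M ℕ.+ i)
      cast = sym (trans (ℤ.pos-+ (j ℕ.* M) i) (trans (cong (_+ + i) (ℤ.pos-* j M)) (ℤ.+-comm (+ j * + M) (+ i))))
      square : ∀ j M → (j * M) * (j * M) ≡ (j * j) * (M * M)
      square = solve-∀
    inner : ∀ j → ∑[ i < M ] ((+ i) ^ suc t + (+ suc t * (+ j * + M)) * (+ i) ^ t) ≡ U + L * + j
    inner j = trans (∑-distrib-+ M _ _) (cong (λ s → U + s)
      (trans (∑-distribˡ-* M (+ suc t * (+ j * + M)) (λ i → (+ i) ^ t)) (regroup (+ suc t) (+ j) (+ M) V)))
      where regroup : ∀ c j M V → (c * (j * M)) * V ≡ c * M * V * j
            regroup = solve-∀
    outer : ∑[ j < c ] (U + L * + j) ≡ + c * U + L * ∑[ j < c ] (+ j)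
    outer = trans (∑-distrib-+ c _ _) (cong₂ _+_ (∑-const c U) (∑-distribˡ-* c L (λ j → + j)))

  powerSum-periodic : ∀ c M t → powerSum (c ℕ.* M) (suc t) ≈ + c * powerSum M (suc t) [mod + M ]
  powerSum-periodic c M t = begin
    powerSum (c ℕ.* M) (suc t)
      ≈⟨ ≈-weaken (ℤ.∣m⇒∣m*n (+ M) ∣-refl) (powerSum-blocks c M t) ⟩
    + c * powerSum M (suc t) + (+ suc t * + M * powerSum M t) * ∑[ j < c ] (+ j)
      ≈⟨ +-cong (≈-refl {+ c * powerSum M (suc t)}) (∣⇒≈0 M∣extra) ⟩
    + c * powerSum M (suc t) + 0ℤ
      ≡⟨ ℤ.+-identityʳ _ ⟩
    + c * powerSum M (suc t) ∎
    where
    open ≈-Reasoning (+ M)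
    M∣extra : + M ∣ (+ suc t * + M * powerSum M t) * ∑[ j < c ] (+ j)
    M∣extra = ℤ.∣m⇒∣m*n (∑[ j < c ] (+ j)) (ℤ.∣m⇒∣m*n (powerSum M t) (ℤ.∣n⇒∣m*n (+ suc t) ∣-refl))

  -- The cross term of powerSum-blocks carries ∑[ j < p ] j, which p divides because p is odd.
  powerSum-lift : ∀ {p} → Prime p → ¬ (2 ℕ.∣ p) → ∀ t E →
    powerSum (p ℕ.^ suc E) (suc t) ≈ (+ p) ^ E * powerSum p (suc t) [mod (+ p) ^ suc E ]
  powerSum-lift {p} pp 2∤p t zero = ≈-reflexive (trans (cong (λ N → powerSum N (suc t)) (ℕ.*-identityʳ p)) (sym (ℤ.*-identityˡ _)))
  powerSum-lift {p} pp 2∤p t (suc E) = begin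
    powerSum (p ℕ.* M) (suc t)
      ≈⟨ ≈-weaken p^[E+2]∣M² (powerSum-blocks p M t) ⟩
    + p * powerSum M (suc t) + (+ suc t * + M * powerSum M t) * ∑[ j < p ] (+ j)
      ≈⟨ +-cong (≈-refl {+ p * powerSum M (suc t)}) (∣⇒≈0 p^[E+2]∣extra) ⟩
    + p * powerSum M (suc t) + 0ℤ
      ≡⟨ ℤ.+-identityʳ _ ⟩
    + p * powerSum M (suc t)
      ≈⟨ scale-cong (+ p) (powerSum-lift pp 2∤p t E) ⟩
    + p * ((+ p) ^ E * powerSum p (suc t))
      ≡⟨ ℤ.*-assoc (+ p) ((+ p) ^ E) _ ⟨
    (+ p) ^ suc E * powerSum p (suc t) ∎
    where
    open ≈-Reasoning ((+ p) ^ suc (suc E))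
    M : ℕ
    M = p ℕ.^ suc E
    +M≡p^[E+1] : + M ≡ (+ p) ^ suc E
    +M≡p^[E+1] = pos-^ p (suc E)
    p^[E+2]∣M² : (+ p) ^ suc (suc E) ∣ + M * + M
    p^[E+2]∣M² = divides ((+ p) ^ E) (trans (cong (λ m → m * m) +M≡p^[E+1]) (square (+ p) ((+ p) ^ E)))
      where square : ∀ p y → (p * y) * (p * y) ≡ y * (p * (p * y))
            square = solve-∀
    p^[E+2]∣extra : (+ p) ^ suc (suc E) ∣ (+ suc t * + M * powerSum M t) * ∑[ j < p ] (+ j)
    p^[E+2]∣extra with p∣∑k pp 2∤p
    ... | divides s ∑k≡s*p = divides (+ suc t * powerSum M t * s)
          (trans (cong₂ (λ m σ → (+ suc t * m * powerSum M t) * σ) +M≡p^[E+1] ∑k≡s*p)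
                 (rearrange (+ suc t) ((+ p) ^ suc E) (powerSum M t) s (+ p)))
      where rearrange : ∀ c M V s p → (c * M * V) * (s * p) ≡ (c * V * s) * (p * M)
            rearrange = solve-∀

open PowerSumsOverBlocks

module Indicators where
  open import Data.Integer using (_+_; _-_; _*_)
  open import Relation.Nullary.Decidable using (_×-dec_; ¬?)

  𝟙 : {A : Set} → Dec A → ℤ
  𝟙 (yes _) = 1ℤ
  𝟙 (no _)  = 0ℤ

  𝟙-yes : {A : Set} (a? : Dec A) → A → 𝟙 a? ≡ 1ℤ
  𝟙-yes (yes _) _ = refl
  𝟙-yes (no ¬a) a = ⊥-elim (¬a a)

  𝟙-no : {A : Set} (a? : Dec A) → ¬ A → 𝟙 a? ≡ 0ℤ
  𝟙-no (yes a) ¬a = ⊥-elim (¬a a)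
  𝟙-no (no _)  _  = refl

  𝟙-cong : {A B : Set} (a? : Dec A) (b? : Dec B) → (A → B) → (B → A) → 𝟙 a? ≡ 𝟙 b?
  𝟙-cong a?      (yes b) _   B→A = 𝟙-yes a? (B→A b)
  𝟙-cong a?      (no ¬b) A→B _   = 𝟙-no a? (λ a → ¬b (A→B a))

  𝟙-× : {A B : Set} (a? : Dec A) (b? : Dec B) → 𝟙 (a? ×-dec b?) ≡ 𝟙 a? * 𝟙 b?
  𝟙-× (yes _) (yes _) = refl
  𝟙-× (yes _) (no _)  = refl
  𝟙-× (no _)  _       = refl

  𝟙-¬ : {A : Set} (a? : Dec A) → 𝟙 (¬? a?) ≡ 1ℤ - 𝟙 a?
  𝟙-¬ (yes _) = refl
  𝟙-¬ (no _)  = refl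

  ∑-multiples : ∀ N d .{{_ : ℕ.NonZero d}} (g : ℕ → ℤ) →
    ∑[ k < N ℕ.* d ] (𝟙 (d ℕ.∣? k) * g k) ≡ ∑[ j < N ] g (j ℕ.* d)
  ∑-multiples N d@(suc d′) g = trans (∑-blocks N d (λ k → 𝟙 (d ℕ.∣? k) * g k)) (∑-cong N (λ {j} _ → block j))
    where
    block : ∀ j → ∑[ i < d ] (𝟙 (d ℕ.∣? j ℕ.* d ℕ.+ i) * g (j ℕ.* d ℕ.+ i)) ≡ g (j ℕ.* d)
    block j = begin
      ∑[ i < d ] (𝟙 (d ℕ.∣? j ℕ.* d ℕ.+ i) * g (j ℕ.* d ℕ.+ i))
        ≡⟨ ∑-unfoldˡ d′ _ ⟩
      𝟙 (d ℕ.∣? j ℕ.* d ℕ.+ 0) * g (j ℕ.* d ℕ.+ 0) + ∑[ i < d′ ] (𝟙 (d ℕ.∣? j ℕ.* d ℕ.+ suc i) * g (j ℕ.* d ℕ.+ suc i))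
        ≡⟨ cong₂ _+_ multiple (trans (∑-cong d′ (λ {i} i<d′ → non-multiple i<d′)) (∑-zero d′)) ⟩
      g (j ℕ.* d) + 0ℤ
        ≡⟨ ℤ.+-identityʳ _ ⟩
      g (j ℕ.* d) ∎
      where
      open ≡-Reasoning
      multiple : 𝟙 (d ℕ.∣? j ℕ.* d ℕ.+ 0) * g (j ℕ.* d ℕ.+ 0) ≡ g (j ℕ.* d)
      multiple rewrite ℕ.+-identityʳ (j ℕ.* d) | 𝟙-yes (d ℕ.∣? j ℕ.* d) (ℕ.n∣m*n j) = ℤ.*-identityˡ _
      non-multiple : ∀ {i} → i ℕ.< d′ → 𝟙 (d ℕ.∣? j ℕ.* d ℕ.+ suc i) * g (j ℕ.* d ℕ.+ suc i) ≡ 0ℤ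
      non-multiple {i} i<d′ = cong (_* g (j ℕ.* d ℕ.+ suc i)) (𝟙-no (d ℕ.∣? j ℕ.* d ℕ.+ suc i) d∤)
        where d∤ : ¬ (d ℕ.∣ j ℕ.* d ℕ.+ suc i)
              d∤ d∣ = ℕ.>⇒∤ (s≤s i<d′) (ℕ.∣m+n∣m⇒∣n d∣ (ℕ.n∣m*n j))

open Indicators

module Coprimality where
  open import Data.Nat.Coprimality using (Coprime; coprime-divisor; coprime⇒gcd≡1)
  open import Data.Nat.GCD using (gcd; gcd-greatest)
  open import Data.Nat.Primality using (euclidsLemma; prime⇒irreducible; prime⇒nonTrivial)

  coprime-* : ∀ {a b c} → Coprime a b → Coprime a c → Coprime a (b ℕ.* c)
  coprime-* cab cac {i} (i∣a , i∣bc) = cac (i∣a , coprime-divisor ci-b i∣bc)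
    where ci-b : Coprime i _
          ci-b (j∣i , j∣b) = cab (ℕ.∣-trans j∣i i∣a , j∣b)

  coprime-^ : ∀ {a b} → Coprime a b → ∀ e → Coprime a (b ℕ.^ e)
  coprime-^ cab zero    (_ , i∣1) = ℕ.∣1⇒≡1 i∣1
  coprime-^ cab (suc e) = coprime-* cab (coprime-^ cab e)

  ∤⇒coprime : ∀ {p k} → Prime p → ¬ (p ℕ.∣ k) → Coprime k p
  ∤⇒coprime pp p∤k {i} (i∣k , i∣p) with prime⇒irreducible pp i∣p
  ... | inj₁ i≡1 = i≡1
  ... | inj₂ refl = ⊥-elim (p∤k i∣k)

  distinct-primes-∤ : ∀ {p q} → Prime p → Prime q → p ≢ q → ¬ (p ℕ.∣ q)
  distinct-primes-∤ {p} pp pq p≢q p∣q with prime⇒irreducible pq p∣q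
  ... | inj₂ p≡q  = p≢q p≡q
  ... | inj₁ refl = ℕ.<-irrefl refl (ℕ.nonTrivial⇒n>1 p {{prime⇒nonTrivial pp}})

  coprime⇒∣-* : ∀ {a b x} → Coprime a b → a ℕ.∣ x → b ℕ.∣ x → a ℕ.* b ℕ.∣ x
  coprime⇒∣-* {a} {b} cab a∣x (ℕ.divides t refl) = ℕ.*-monoˡ-∣ b (coprime-divisor cab (subst (a ℕ.∣_) (ℕ.*-comm t b) a∣x))

  distinct-primes-∣⇒∣-* : ∀ {p q k} → Prime p → Prime q → p ≢ q → p ℕ.∣ k → q ℕ.∣ k → p ℕ.* q ℕ.∣ k
  distinct-primes-∣⇒∣-* pp pq p≢q = coprime⇒∣-* (∤⇒coprime pq (distinct-primes-∤ pq pp (≢-sym p≢q)))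

  prime∤⇒∤^ : ∀ {p q} → Prime p → ¬ (p ℕ.∣ q) → ∀ f → ¬ (p ℕ.∣ q ℕ.^ f)
  prime∤⇒∤^ {p} pp p∤q zero    p∣1 = ℕ.<-irrefl (sym (ℕ.∣1⇒≡1 p∣1)) (ℕ.nonTrivial⇒n>1 p {{prime⇒nonTrivial pp}})
  prime∤⇒∤^ {p} {q} pp p∤q (suc f) p∣qᶠ⁺¹ with euclidsLemma q (q ℕ.^ f) pp p∣qᶠ⁺¹
  ... | inj₁ p∣q  = p∤q p∣q
  ... | inj₂ p∣qᶠ = prime∤⇒∤^ pp p∤q f p∣qᶠ

  gcd≡1⇒prime∤ : ∀ {d k n} → Prime d → d ℕ.∣ n → gcd k n ≡ 1 → ¬ (d ℕ.∣ k)
  gcd≡1⇒prime∤ {d} pd d∣n gcd≡1 d∣k =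
    ℕ.<-irrefl (sym (ℕ.∣1⇒≡1 (subst (d ℕ.∣_) gcd≡1 (gcd-greatest d∣k d∣n)))) (ℕ.nonTrivial⇒n>1 d {{prime⇒nonTrivial pd}})

  primes∤⇒gcd≡1 : ∀ {p q k} → Prime p → Prime q → ¬ (p ℕ.∣ k) → ¬ (q ℕ.∣ k) → ∀ e f → gcd k (p ℕ.^ e ℕ.* q ℕ.^ f) ≡ 1
  primes∤⇒gcd≡1 pp pq p∤k q∤k e f =
    coprime⇒gcd≡1 (coprime-* (coprime-^ (∤⇒coprime pp p∤k) e) (coprime-^ (∤⇒coprime pq q∤k) f))

open Coprimality

module TwoPrimePowers {p q} (p-prime : Prime p) (q-prime : Prime q) (p≢q : p ≢ q) (e f : ℕ) where
  open import Data.Integer using (_+_; _-_; _*_)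
  open import Data.Nat.GCD using (gcd)
  open import Relation.Nullary.Decidable using (_×-dec_; ¬?)

  n : ℕ
  n = p ℕ.^ suc e ℕ.* q ℕ.^ suc f

  p∣n : p ℕ.∣ n
  p∣n = ℕ.∣-trans (ℕ.m∣m*n (p ℕ.^ e)) (ℕ.m∣m*n (q ℕ.^ suc f))

  q∣n : q ℕ.∣ n
  q∣n = ℕ.∣-trans (ℕ.m∣m*n (q ℕ.^ f)) (ℕ.n∣m*n (p ℕ.^ suc e))

  𝟙-coprime : ∀ k → 𝟙 (gcd k n ℕ.≟ 1) ≡ (1ℤ - 𝟙 (p ℕ.∣? k)) * (1ℤ - 𝟙 (q ℕ.∣? k))
  𝟙-coprime k = begin
    𝟙 (gcd k n ℕ.≟ 1)                            ≡⟨ 𝟙-cong (gcd k n ℕ.≟ 1) (¬? (p ℕ.∣? k) ×-dec ¬? (q ℕ.∣? k)) ⇒ ⇐ ⟩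
    𝟙 (¬? (p ℕ.∣? k) ×-dec ¬? (q ℕ.∣? k))         ≡⟨ 𝟙-× (¬? (p ℕ.∣? k)) (¬? (q ℕ.∣? k)) ⟩
    𝟙 (¬? (p ℕ.∣? k)) * 𝟙 (¬? (q ℕ.∣? k))         ≡⟨ cong₂ _*_ (𝟙-¬ (p ℕ.∣? k)) (𝟙-¬ (q ℕ.∣? k)) ⟩
    (1ℤ - 𝟙 (p ℕ.∣? k)) * (1ℤ - 𝟙 (q ℕ.∣? k))     ∎
    where
    open ≡-Reasoning
    ⇒ : gcd k n ≡ 1 → ¬ (p ℕ.∣ k) × ¬ (q ℕ.∣ k)
    ⇒ gcd≡1 = gcd≡1⇒prime∤ p-prime p∣n gcd≡1 , gcd≡1⇒prime∤ q-prime q∣n gcd≡1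
    ⇐ : ¬ (p ℕ.∣ k) × ¬ (q ℕ.∣ k) → gcd k n ≡ 1
    ⇐ (p∤k , q∤k) = primes∤⇒gcd≡1 p-prime q-prime p∤k q∤k (suc e) (suc f)

  𝟙-∣-* : ∀ k → 𝟙 (p ℕ.∣? k) * 𝟙 (q ℕ.∣? k) ≡ 𝟙 (p ℕ.* q ℕ.∣? k)
  𝟙-∣-* k = trans (sym (𝟙-× (p ℕ.∣? k) (q ℕ.∣? k))) (𝟙-cong (p ℕ.∣? k ×-dec q ℕ.∣? k) (p ℕ.* q ℕ.∣? k) ⇒ ⇐)
    where
    ⇒ : p ℕ.∣ k × q ℕ.∣ k → p ℕ.* q ℕ.∣ k
    ⇒ (p∣k , q∣k) = distinct-primes-∣⇒∣-* p-prime q-prime p≢q p∣k q∣k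
    ⇐ : p ℕ.* q ℕ.∣ k → p ℕ.∣ k × q ℕ.∣ k
    ⇐ pq∣k = ℕ.∣-trans (ℕ.m∣m*n q) pq∣k , ℕ.∣-trans (ℕ.n∣m*n p) pq∣k

  inclusion–exclusion : ∀ (g : ℕ → ℤ) →
    ∑[ k < n ] (𝟙 (gcd k n ℕ.≟ 1) * g k)
      ≡ ∑ n g - ∑[ k < n ] (𝟙 (p ℕ.∣? k) * g k) - ∑[ k < n ] (𝟙 (q ℕ.∣? k) * g k) + ∑[ k < n ] (𝟙 (p ℕ.* q ℕ.∣? k) * g k)
  inclusion–exclusion g = begin
    ∑[ k < n ] (𝟙 (gcd k n ℕ.≟ 1) * g k)
      ≡⟨ ∑-cong n (λ {k} _ → pointwise k) ⟩
    ∑[ k < n ] (g k - 𝟙 (p ℕ.∣? k) * g k - 𝟙 (q ℕ.∣? k) * g k + 𝟙 (p ℕ.* q ℕ.∣? k) * g k)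
      ≡⟨ ∑-distrib-+ n _ _ ⟩
    ∑[ k < n ] (g k - 𝟙 (p ℕ.∣? k) * g k - 𝟙 (q ℕ.∣? k) * g k) + ∑[ k < n ] (𝟙 (p ℕ.* q ℕ.∣? k) * g k)
      ≡⟨ cong (_+ ∑[ k < n ] (𝟙 (p ℕ.* q ℕ.∣? k) * g k)) (trans (∑-distrib-sub n _ _) (cong (_- ∑[ k < n ] (𝟙 (q ℕ.∣? k) * g k))
                                                                                    (∑-distrib-sub n g (λ k → 𝟙 (p ℕ.∣? k) * g k)))) ⟩
    ∑ n g - ∑[ k < n ] (𝟙 (p ℕ.∣? k) * g k) - ∑[ k < n ] (𝟙 (q ℕ.∣? k) * g k) + ∑[ k < n ] (𝟙 (p ℕ.* q ℕ.∣? k) * g k) ∎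
    where
    open ≡-Reasoning
    pointwise : ∀ k → 𝟙 (gcd k n ℕ.≟ 1) * g k ≡ g k - 𝟙 (p ℕ.∣? k) * g k - 𝟙 (q ℕ.∣? k) * g k + 𝟙 (p ℕ.* q ℕ.∣? k) * g k
    pointwise k = begin
      𝟙 (gcd k n ℕ.≟ 1) * g k
        ≡⟨ cong (_* g k) (𝟙-coprime k) ⟩
      (1ℤ - 𝟙 (p ℕ.∣? k)) * (1ℤ - 𝟙 (q ℕ.∣? k)) * g k
        ≡⟨ expand (𝟙 (p ℕ.∣? k)) (𝟙 (q ℕ.∣? k)) (g k) ⟩
      g k - 𝟙 (p ℕ.∣? k) * g k - 𝟙 (q ℕ.∣? k) * g k + 𝟙 (p ℕ.∣? k) * 𝟙 (q ℕ.∣? k) * g k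
        ≡⟨ cong (λ c → g k - 𝟙 (p ℕ.∣? k) * g k - 𝟙 (q ℕ.∣? k) * g k + c * g k) (𝟙-∣-* k) ⟩
      g k - 𝟙 (p ℕ.∣? k) * g k - 𝟙 (q ℕ.∣? k) * g k + 𝟙 (p ℕ.* q ℕ.∣? k) * g k ∎
      where expand : ∀ a b g → (1ℤ - a) * (1ℤ - b) * g ≡ g - a * g - b * g + a * b * g
            expand = solve-∀

module CoprimePowerSums where
  open import Data.Integer using (_+_; _-_; _*_; _^_)
  open import Data.Nat.GCD using (gcd)

  coprimePowerSum : ℕ → ℕ → ℤ
  coprimePowerSum n t = ∑[ k < n ] (𝟙 (gcd k n ℕ.≟ 1) * (+ k) ^ t)

  coprimeCount : ℕ → ℤ
  coprimeCount n = ∑[ k < n ] 𝟙 (gcd k n ℕ.≟ 1)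

  Δ : ℕ → ℕ → ℕ → ℤ
  Δ p q t = (+ q - (+ q) ^ t) * powerSum p t + + q - 1ℤ

open CoprimePowerSums

module ModuloPrimePower {p q} (p-prime : Prime p) (q-prime : Prime q) (p≢q : p ≢ q) (e f : ℕ) where
  open import Data.Integer using (_+_; _-_; _*_; _^_)
  open import Data.Integer.Divisibility.Signed using (_∣_; divides)
  open import Data.Nat.GCD using (gcd)
  import Data.Nat.Tactic.RingSolver as ℕ-Solver
  open TwoPrimePowers p-prime q-prime p≢q e f

  private
    instance
      p≢0 : ℕ.NonZero p
      p≢0 = prime⇒nonZero p-prime
      q≢0 : ℕ.NonZero q
      q≢0 = prime⇒nonZero q-prime
      pq≢0 : ℕ.NonZero (p ℕ.* q)
      pq≢0 = ℕ.m*n≢0 p q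
    P Q : ℤ
    P = + p
    Q = + q

  n≡[q^[f+1]]*p^[e+1] : n ≡ q ℕ.^ suc f ℕ.* p ℕ.^ suc e
  n≡[q^[f+1]]*p^[e+1] = ℕ.*-comm (p ℕ.^ suc e) (q ℕ.^ suc f)

  n≡[p^e*q^[f+1]]*p : n ≡ p ℕ.^ e ℕ.* q ℕ.^ suc f ℕ.* p
  n≡[p^e*q^[f+1]]*p = reorder p (p ℕ.^ e) (q ℕ.^ suc f)
    where reorder : ∀ p a b → (p ℕ.* a) ℕ.* b ≡ a ℕ.* b ℕ.* p
          reorder = ℕ-Solver.solve-∀

  n≡[p^[e+1]*q^f]*q : n ≡ p ℕ.^ suc e ℕ.* q ℕ.^ f ℕ.* q
  n≡[p^[e+1]*q^f]*q = reorder q (p ℕ.^ suc e) (q ℕ.^ f)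
    where reorder : ∀ q a b → a ℕ.* (q ℕ.* b) ≡ a ℕ.* b ℕ.* q
          reorder = ℕ-Solver.solve-∀

  n≡[p^e*q^f]*[p*q] : n ≡ p ℕ.^ e ℕ.* q ℕ.^ f ℕ.* (p ℕ.* q)
  n≡[p^e*q^f]*[p*q] = reorder p q (p ℕ.^ e) (q ℕ.^ f)
    where reorder : ∀ p q a b → (p ℕ.* a) ℕ.* (q ℕ.* b) ≡ a ℕ.* b ℕ.* (p ℕ.* q)
          reorder = ℕ-Solver.solve-∀

  ∑-𝟙∣ : ∀ N d .{{_ : ℕ.NonZero d}} → n ≡ N ℕ.* d → ∀ g → ∑[ k < n ] (𝟙 (d ℕ.∣? k) * g k) ≡ ∑[ j < N ] g (j ℕ.* d)
  ∑-𝟙∣ N d n≡N*d g = trans (cong (λ m → ∑[ k < m ] (𝟙 (d ℕ.∣? k) * g k)) n≡N*d) (∑-multiples N d g)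

  count-multiples : ∀ N d .{{_ : ℕ.NonZero d}} → n ≡ N ℕ.* d → ∑[ k < n ] (𝟙 (d ℕ.∣? k) * 1ℤ) ≡ + N
  count-multiples N d n≡N*d = trans (∑-𝟙∣ N d n≡N*d (λ _ → 1ℤ)) (trans (∑-const N 1ℤ) (ℤ.*-identityʳ (+ N)))

  coprimeCount≡ : coprimeCount n ≡ P ^ suc e * Q ^ suc f - P ^ e * Q ^ suc f - P ^ suc e * Q ^ f + P ^ e * Q ^ f
  coprimeCount≡ = begin
    coprimeCount n
      ≡⟨ ∑-cong n (λ {k} _ → sym (ℤ.*-identityʳ (𝟙 (gcd k n ℕ.≟ 1)))) ⟩
    ∑[ k < n ] (𝟙 (gcd k n ℕ.≟ 1) * 1ℤ)
      ≡⟨ inclusion–exclusion (λ _ → 1ℤ) ⟩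
    ∑[ k < n ] 1ℤ - ∑[ k < n ] (𝟙 (p ℕ.∣? k) * 1ℤ) - ∑[ k < n ] (𝟙 (q ℕ.∣? k) * 1ℤ) + ∑[ k < n ] (𝟙 (p ℕ.* q ℕ.∣? k) * 1ℤ)
      ≡⟨ cong₂ _+_ (cong₂ _-_ (cong₂ _-_ (trans (∑-const n 1ℤ) (ℤ.*-identityʳ (+ n)))
                                          (count-multiples (p ℕ.^ e ℕ.* q ℕ.^ suc f) p n≡[p^e*q^[f+1]]*p))
                              (count-multiples (p ℕ.^ suc e ℕ.* q ℕ.^ f) q n≡[p^[e+1]*q^f]*q))
                   (count-multiples (p ℕ.^ e ℕ.* q ℕ.^ f) (p ℕ.* q) n≡[p^e*q^f]*[p*q]) ⟩
    + n - + (p ℕ.^ e ℕ.* q ℕ.^ suc f) - + (p ℕ.^ suc e ℕ.* q ℕ.^ f) + + (p ℕ.^ e ℕ.* q ℕ.^ f)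
      ≡⟨ cong₂ _+_ (cong₂ _-_ (cong₂ _-_ (pos-^*^ p (suc e) q (suc f)) (pos-^*^ p e q (suc f))) (pos-^*^ p (suc e) q f))
                   (pos-^*^ p e q f) ⟩
    P ^ suc e * Q ^ suc f - P ^ e * Q ^ suc f - P ^ suc e * Q ^ f + P ^ e * Q ^ f ∎
    where open ≡-Reasoning

  module _ (t : ℕ) (e≤t : e ℕ.≤ t) where

    U : ℤ
    U = powerSum (p ℕ.^ suc e) (suc t)

    periodic : ∀ c → powerSum (c ℕ.* p ℕ.^ suc e) (suc t) ≈ + c * U [mod P ^ suc e ]
    periodic c = subst (λ m → powerSum (c ℕ.* p ℕ.^ suc e) (suc t) ≈ + c * U [mod m ]) (pos-^ p (suc e)) (powerSum-periodic c (p ℕ.^ suc e) t)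

    multiples-of-p-vanish : ∀ N d → p ℕ.∣ d → ∑[ j < N ] (+ (j ℕ.* d)) ^ suc t ≈ 0ℤ [mod P ^ suc e ]
    multiples-of-p-vanish N d p∣d = ∣⇒≈0 (∑-∣ N (λ j → (+ (j ℕ.* d)) ^ suc t) (λ {j} _ →
      ℤ.∣-trans (≤⇒^∣^ P (s≤s e≤t)) (∣⇒^∣^ (ℤ.∣ᵤ⇒∣ {k = P} {i = + (j ℕ.* d)} (ℕ.∣-trans p∣d (ℕ.n∣m*n j))) (suc t))))

    coprimePowerSum≈ : coprimePowerSum n (suc t) ≈ Q ^ suc f * U - Q ^ suc t * (Q ^ f * U) [mod P ^ suc e ]
    coprimePowerSum≈ = begin
      coprimePowerSum n (suc t)
        ≡⟨ inclusion–exclusion (λ k → (+ k) ^ suc t) ⟩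
      powerSum n (suc t) - ∑[ k < n ] (𝟙 (p ℕ.∣? k) * (+ k) ^ suc t) - ∑[ k < n ] (𝟙 (q ℕ.∣? k) * (+ k) ^ suc t)
        + ∑[ k < n ] (𝟙 (p ℕ.* q ℕ.∣? k) * (+ k) ^ suc t)
        ≡⟨ cong₂ (λ a b → A - a + b) (∑-𝟙∣ (p ℕ.^ suc e ℕ.* q ℕ.^ f) q n≡[p^[e+1]*q^f]*q (λ k → (+ k) ^ suc t))
                                     (∑-𝟙∣ (p ℕ.^ e ℕ.* q ℕ.^ f) (p ℕ.* q) n≡[p^e*q^f]*[p*q] (λ k → (+ k) ^ suc t)) ⟩
      A - ∑[ j < p ℕ.^ suc e ℕ.* q ℕ.^ f ] (+ (j ℕ.* q)) ^ suc t
        + ∑[ j < p ℕ.^ e ℕ.* q ℕ.^ f ] (+ (j ℕ.* (p ℕ.* q))) ^ suc t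
        ≈⟨ +-cong (sub-cong (sub-cong all p-part) q-part) (multiples-of-p-vanish (p ℕ.^ e ℕ.* q ℕ.^ f) (p ℕ.* q) (ℕ.m∣m*n q)) ⟩
      Q ^ suc f * U - 0ℤ - Q ^ suc t * (Q ^ f * U) + 0ℤ
        ≡⟨ drop-zeros (Q ^ suc f * U) (Q ^ suc t * (Q ^ f * U)) ⟩
      Q ^ suc f * U - Q ^ suc t * (Q ^ f * U) ∎
      where
      open ≈-Reasoning (P ^ suc e)
      A : ℤ
      A = powerSum n (suc t) - ∑[ k < n ] (𝟙 (p ℕ.∣? k) * (+ k) ^ suc t)
      drop-zeros : ∀ a b → a - 0ℤ - b + 0ℤ ≡ a - b
      drop-zeros = solve-∀
      all : powerSum n (suc t) ≈ Q ^ suc f * U [mod P ^ suc e ]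
      all = subst₂ (λ m c → powerSum m (suc t) ≈ c * U [mod P ^ suc e ])
              (sym n≡[q^[f+1]]*p^[e+1]) (pos-^ q (suc f)) (periodic (q ℕ.^ suc f))
      p-part : ∑[ k < n ] (𝟙 (p ℕ.∣? k) * (+ k) ^ suc t) ≈ 0ℤ [mod P ^ suc e ]
      p-part = subst (_≈ 0ℤ [mod P ^ suc e ]) (sym (∑-𝟙∣ (p ℕ.^ e ℕ.* q ℕ.^ suc f) p n≡[p^e*q^[f+1]]*p (λ k → (+ k) ^ suc t)))
                 (multiples-of-p-vanish (p ℕ.^ e ℕ.* q ℕ.^ suc f) p ℕ.∣-refl)
      q-part : ∑[ j < p ℕ.^ suc e ℕ.* q ℕ.^ f ] (+ (j ℕ.* q)) ^ suc t ≈ Q ^ suc t * (Q ^ f * U) [mod P ^ suc e ]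
      q-part = begin
        ∑[ j < p ℕ.^ suc e ℕ.* q ℕ.^ f ] (+ (j ℕ.* q)) ^ suc t
          ≡⟨ ∑-cong (p ℕ.^ suc e ℕ.* q ℕ.^ f) (λ {j} _ → factor j) ⟩
        ∑[ j < p ℕ.^ suc e ℕ.* q ℕ.^ f ] (Q ^ suc t * (+ j) ^ suc t)
          ≡⟨ ∑-distribˡ-* (p ℕ.^ suc e ℕ.* q ℕ.^ f) (Q ^ suc t) (λ j → (+ j) ^ suc t) ⟩
        Q ^ suc t * powerSum (p ℕ.^ suc e ℕ.* q ℕ.^ f) (suc t)
          ≡⟨ cong (λ m → Q ^ suc t * powerSum m (suc t)) (ℕ.*-comm (p ℕ.^ suc e) (q ℕ.^ f)) ⟩
        Q ^ suc t * powerSum (q ℕ.^ f ℕ.* p ℕ.^ suc e) (suc t)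
          ≈⟨ *-congˡ (Q ^ suc t) (periodic (q ℕ.^ f)) ⟩
        Q ^ suc t * (+ (q ℕ.^ f) * U)
          ≡⟨ cong (λ c → Q ^ suc t * (c * U)) (pos-^ q f) ⟩
        Q ^ suc t * (Q ^ f * U) ∎
        where factor : ∀ j → (+ (j ℕ.* q)) ^ suc t ≡ Q ^ suc t * (+ j) ^ suc t
              factor j = trans (cong (_^ suc t) (trans (ℤ.pos-* j q) (ℤ.*-comm (+ j) Q))) (^-distribʳ-* Q (+ j) (suc t))

    module _ (p-odd : ¬ (2 ℕ.∣ p)) where

      coprimePowerSum-coprimeCount≈ :
        coprimePowerSum n (suc t) - coprimeCount n ≈ P ^ e * (Q ^ f * Δ p q (suc t)) [mod P ^ suc e ]
      coprimePowerSum-coprimeCount≈ = begin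
        coprimePowerSum n (suc t) - coprimeCount n
          ≈⟨ sub-cong coprimePowerSum≈ (≈-reflexive coprimeCount≡) ⟩
        Q ^ suc f * U - Q ^ suc t * (Q ^ f * U) - φ′
          ≈⟨ sub-cong (sub-cong (*-congˡ (Q ^ suc f) lift) (*-congˡ (Q ^ suc t) (*-congˡ (Q ^ f) lift))) (≈-refl {φ′}) ⟩
        Q ^ suc f * (P ^ e * U₁) - Q ^ suc t * (Q ^ f * (P ^ e * U₁)) - φ′
          ≈⟨ mk≈ (divides (Q ^ f - Q ^ suc f) (collect Q (Q ^ f) P (P ^ e) U₁ (Q ^ suc t))) ⟩
        P ^ e * (Q ^ f * Δ p q (suc t)) ∎
        where
        open ≈-Reasoning (P ^ suc e)
        U₁ φ′ : ℤ
        U₁ = powerSum p (suc t)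
        φ′ = P ^ suc e * Q ^ suc f - P ^ e * Q ^ suc f - P ^ suc e * Q ^ f + P ^ e * Q ^ f
        lift : U ≈ P ^ e * U₁ [mod P ^ suc e ]
        lift = powerSum-lift p-prime p-odd t e
        collect : ∀ Q Qᶠ P Pᵉ U₁ Qᵗ →
          Q * Qᶠ * (Pᵉ * U₁) - Qᵗ * (Qᶠ * (Pᵉ * U₁)) - (P * Pᵉ * (Q * Qᶠ) - Pᵉ * (Q * Qᶠ) - P * Pᵉ * Qᶠ + Pᵉ * Qᶠ)
            - Pᵉ * (Qᶠ * ((Q - Qᵗ) * U₁ + Q - 1ℤ))
          ≡ (Qᶠ - Q * Qᶠ) * (P * Pᵉ)
        collect = solve-∀

      p^[e+1]∣⇔p∣Δ : (P ^ suc e ∣ coprimePowerSum n (suc t) - coprimeCount n) ⇔ (P ∣ Δ p q (suc t))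
      p^[e+1]∣⇔p∣Δ = mk⇔ ⇒ ⇐
        where
        instance
          pᵉ≢0 : ℤ.NonZero (P ^ e)
          pᵉ≢0 = subst ℤ.NonZero (pos-^ p e) (ℕ.m^n≢0 p e)
        p∤qᶠ : ¬ (P ∣ Q ^ f)
        p∤qᶠ p∣qᶠ = prime∤⇒∤^ p-prime (distinct-primes-∤ p-prime q-prime p≢q) f
                      (subst (p ℕ.∣_) (cong ℤ.∣_∣ (sym (pos-^ q f))) (ℤ.∣⇒∣ᵤ p∣qᶠ))
        P^[e+1]≡P^e*P : P ^ suc e ≡ P ^ e * P
        P^[e+1]≡P^e*P = ℤ.*-comm P (P ^ e)
        ⇒ : P ^ suc e ∣ coprimePowerSum n (suc t) - coprimeCount n → P ∣ Δ p q (suc t)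
        ⇒ p^[e+1]∣ = euclidsLemma-∤ p-prime p∤qᶠ (ℤ.*-cancelˡ-∣ (P ^ e) (subst (_∣ P ^ e * (Q ^ f * Δ p q (suc t))) P^[e+1]≡P^e*P
                       (≈0⇒∣ (≈-trans (≈-sym coprimePowerSum-coprimeCount≈) (∣⇒≈0 p^[e+1]∣)))))
        ⇐ : P ∣ Δ p q (suc t) → P ^ suc e ∣ coprimePowerSum n (suc t) - coprimeCount n
        ⇐ p∣Δ = ≈0⇒∣ (≈-trans coprimePowerSum-coprimeCount≈ (∣⇒≈0 (subst (_∣ P ^ e * (Q ^ f * Δ p q (suc t))) (sym P^[e+1]≡P^e*P)
                       (ℤ.*-monoʳ-∣ (P ^ e) (ℤ.∣n⇒∣m*n (Q ^ f) p∣Δ)))))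

module DeltaCriterion where
  open import Data.Integer using (_+_; _-_; _*_; _^_)
  open import Data.Integer.Divisibility.Signed using (_∣_)

  ∣∸1⇒≈1 : ∀ {d N} → 1 ℕ.≤ N → d ℕ.∣ N ℕ.∸ 1 → + N ≈ 1ℤ [mod + d ]
  ∣∸1⇒≈1 {d} {N} 1≤N d∣N-1 = mk≈ (subst (+ d ∣_) (pos-∸ 1≤N) (ℤ.∣ᵤ⇒∣ {+ d} {+ (N ℕ.∸ 1)} d∣N-1))

  ≈1⇒∣∸1 : ∀ {d N} → 1 ℕ.≤ N → + N ≈ 1ℤ [mod + d ] → d ℕ.∣ N ℕ.∸ 1
  ≈1⇒∣∸1 {d} {N} 1≤N (mk≈ d∣N-1) = ℤ.∣⇒∣ᵤ {+ d} {+ (N ℕ.∸ 1)} (subst (+ d ∣_) (sym (pos-∸ 1≤N)) d∣N-1)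

  p∣Δ⇔ : ∀ {p q t} → Prime p → Prime q → p ≢ q → 0 ℕ.< t → (+ p ∣ Δ p q t) ⇔ (p ℕ.∣ q ℕ.∸ 1 ⊎ (p ℕ.∸ 1) ℕ.∣ t)
  p∣Δ⇔ {p} {q} {t} p-prime q-prime p≢q 0<t = mk⇔ ⇒ ⇐
    where
    open ≈-Reasoning (+ p)
    Q S : ℤ
    Q = + q
    S = powerSum p t
    1≤q : 1 ℕ.≤ q
    1≤q = ℕ.>-nonZero⁻¹ q {{prime⇒nonZero q-prime}}
    1≤p : 1 ℕ.≤ p
    1≤p = ℕ.>-nonZero⁻¹ p {{prime⇒nonZero p-prime}}
    ⇒ : + p ∣ Δ p q t → p ℕ.∣ q ℕ.∸ 1 ⊎ (p ℕ.∸ 1) ℕ.∣ t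
    ⇒ p∣Δ with (p ℕ.∸ 1) ℕ.∣? t
    ... | yes p-1∣t = inj₂ p-1∣t
    ... | no  p-1∤t = inj₁ (≈1⇒∣∸1 1≤q (mk≈ (≈0⇒∣ (begin
      Q - 1ℤ                        ≡⟨ drop-zero (Q - Q ^ t) Q ⟨
      (Q - Q ^ t) * 0ℤ + Q - 1ℤ     ≈⟨ sub-cong (+-cong (*-congˡ (Q - Q ^ t) S≈0) (≈-refl {Q})) (≈-refl {1ℤ}) ⟨
      Δ p q t                       ≈⟨ ∣⇒≈0 p∣Δ ⟩
      0ℤ                            ∎))))
      where S≈0 : S ≈ 0ℤ [mod + p ]
            S≈0 = ∣⇒≈0 (powerSum-vanishes p-prime p-1∤t)
            drop-zero : ∀ a Q → a * 0ℤ + Q - 1ℤ ≡ Q - 1ℤ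
            drop-zero = solve-∀
    ⇐ : p ℕ.∣ q ℕ.∸ 1 ⊎ (p ℕ.∸ 1) ℕ.∣ t → + p ∣ Δ p q t
    ⇐ (inj₁ p∣q-1) = ≈0⇒∣ (begin
      Δ p q t                          ≈⟨ sub-cong (+-cong (*-cong (sub-cong q≈1 (^-cong t q≈1)) (≈-refl {S})) q≈1) (≈-refl {1ℤ}) ⟩
      (1ℤ - 1ℤ ^ t) * S + 1ℤ - 1ℤ      ≡⟨ cong (λ u → (1ℤ - u) * S + 1ℤ - 1ℤ) (ℤ.^-zeroˡ t) ⟩
      (1ℤ - 1ℤ) * S + 1ℤ - 1ℤ          ≡⟨ vanish S ⟩
      0ℤ                               ∎)
      where q≈1 : Q ≈ 1ℤ [mod + p ]
            q≈1 = ∣∸1⇒≈1 1≤q p∣q-1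
            vanish : ∀ s → (1ℤ - 1ℤ) * s + 1ℤ - 1ℤ ≡ 0ℤ
            vanish = solve-∀
    ⇐ (inj₂ p-1∣t) = ≈0⇒∣ (begin
      Δ p q t                          ≈⟨ sub-cong (+-cong (*-cong (sub-cong (≈-refl {Q}) qᵗ≈1) S≈p-1) (≈-refl {Q})) (≈-refl {1ℤ}) ⟩
      (Q - 1ℤ) * + (p ℕ.∸ 1) + Q - 1ℤ  ≡⟨ cong (λ u → (Q - 1ℤ) * u + Q - 1ℤ) (pos-∸ 1≤p) ⟩
      (Q - 1ℤ) * (+ p - 1ℤ) + Q - 1ℤ   ≡⟨ factor Q (+ p) ⟩
      (Q - 1ℤ) * + p                   ≈⟨ ∣⇒≈0 (ℤ.∣n⇒∣m*n (Q - 1ℤ) ℤ.∣-refl) ⟩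
      0ℤ                               ∎)
      where qᵗ≈1 : Q ^ t ≈ 1ℤ [mod + p ]
            qᵗ≈1 = fermat-∣ p-prime (distinct-primes-∤ p-prime q-prime p≢q) p-1∣t
            S≈p-1 : S ≈ + (p ℕ.∸ 1) [mod + p ]
            S≈p-1 = powerSum≈p-1 p-prime 0<t p-1∣t
            factor : ∀ Q P → (Q - 1ℤ) * (P - 1ℤ) + Q - 1ℤ ≡ (Q - 1ℤ) * P
            factor = solve-∀

open DeltaCriterion

module ListSums where
  open import Data.Integer using (_+_; _*_)
  open import Data.List using (_∷_; filter; map; length; applyUpTo)
  open import Data.Nat.ListAction using (sum)
  open import Relation.Unary using (Pred; Decidable)

  module _ {P : Pred ℕ 0ℓ} (P? : Decidable P) where

    sum-filter-∷ : ∀ (g : ℕ → ℕ) x xs →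
      + sum (map g (filter P? (x ∷ xs))) ≡ 𝟙 (P? x) * + g x + + sum (map g (filter P? xs))
    sum-filter-∷ g x xs with P? x
    ... | yes _ = trans (ℤ.pos-+ (g x) _) (cong (_+ + sum (map g (filter P? xs))) (sym (ℤ.*-identityˡ (+ g x))))
    ... | no _  = sym (ℤ.+-identityˡ _)

    length-filter-∷ : ∀ x xs → + length (filter P? (x ∷ xs)) ≡ 𝟙 (P? x) + + length (filter P? xs)
    length-filter-∷ x xs with P? x
    ... | yes _ = ℤ.pos-+ 1 _
    ... | no _  = sym (ℤ.+-identityˡ _)

    sum-filter : ∀ (g : ℕ → ℕ) N h → + sum (map g (filter P? (applyUpTo h N))) ≡ ∑[ k < N ] (𝟙 (P? (h k)) * + g (h k))
    sum-filter g zero    h = refl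
    sum-filter g (suc N) h = trans (sum-filter-∷ g (h 0) (applyUpTo (λ k → h (suc k)) N))
      (trans (cong (λ s → 𝟙 (P? (h 0)) * + g (h 0) + s) (sum-filter g N (λ k → h (suc k))))
             (sym (∑-unfoldˡ N (λ k → 𝟙 (P? (h k)) * + g (h k)))))

    length-filter : ∀ N h → + length (filter P? (applyUpTo h N)) ≡ ∑[ k < N ] 𝟙 (P? (h k))
    length-filter zero    h = refl
    length-filter (suc N) h = trans (length-filter-∷ (h 0) (applyUpTo (λ k → h (suc k)) N))
      (trans (cong (λ s → 𝟙 (P? (h 0)) + s) (length-filter N (λ k → h (suc k))))
             (sym (∑-unfoldˡ N (λ k → 𝟙 (P? (h k))))))

open ListSums

module WeakCarmichaelAsDivisibility where
  open import Data.Integer using (_+_; _-_; _*_; _^_)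
  open import Data.Integer.Divisibility.Signed using (_∣_; ∣ᵤ⇒∣; ∣⇒∣ᵤ)
  open import Data.List using (filter; map; length; applyUpTo; upTo)
  open import Data.List.Properties using (map-upTo)
  open import Data.Nat.ListAction using (sum)
  open import Data.Nat.GCD using (gcd; gcd-greatest)
  open import Data.Nat.Primality using (Composite)

  -- Defs sums over 1 ≤ k ≤ n - 1 and counts over 1 ≤ k ≤ n, whereas ∑ ranges over 0 ≤ k < n;
  -- the terms k = 0 and k = n are not coprime to n ≥ 2.
  module _ (m : ℕ) where
    private
      n : ℕ
      n = suc (suc m)
      coprime? : (k : ℕ) → Dec (gcd k n ≡ 1)
      coprime? k = gcd k n ℕ.≟ 1

    gcd[0,n]≢1 : gcd 0 n ≢ 1
    gcd[0,n]≢1 g≡1 with ℕ.∣1⇒≡1 (subst (n ℕ.∣_) g≡1 (gcd-greatest (n ℕ.∣0) ℕ.∣-refl))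
    ... | ()

    gcd[n,n]≢1 : gcd n n ≢ 1
    gcd[n,n]≢1 g≡1 with ℕ.∣1⇒≡1 (subst (n ℕ.∣_) g≡1 (gcd-greatest ℕ.∣-refl ℕ.∣-refl))
    ... | ()

    sum-coprimesUpTo : + sum (map (λ k → k ℕ.^ (n ℕ.∸ 1)) (coprimesUpTo (n ℕ.∸ 1) n)) ≡ coprimePowerSum n (n ℕ.∸ 1)
    sum-coprimesUpTo = begin
      + sum (map (λ k → k ℕ.^ suc m) (filter coprime? (map suc (upTo (suc m)))))
        ≡⟨ cong (λ ks → + sum (map (λ k → k ℕ.^ suc m) (filter coprime? ks))) (map-upTo suc (suc m)) ⟩
      + sum (map (λ k → k ℕ.^ suc m) (filter coprime? (applyUpTo suc (suc m))))
        ≡⟨ sum-filter coprime? (λ k → k ℕ.^ suc m) (suc m) suc ⟩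
      ∑[ k < suc m ] (𝟙 (coprime? (suc k)) * + (suc k ℕ.^ suc m))
        ≡⟨ ∑-cong (suc m) (λ {k} _ → cong (𝟙 (coprime? (suc k)) *_) (pos-^ (suc k) (suc m))) ⟩
      ∑[ k < suc m ] (𝟙 (coprime? (suc k)) * (+ suc k) ^ suc m)
        ≡⟨ ℤ.+-identityˡ _ ⟨
      0ℤ + ∑[ k < suc m ] (𝟙 (coprime? (suc k)) * (+ suc k) ^ suc m)
        ≡⟨ cong (λ c → c * (+ 0) ^ suc m + ∑[ k < suc m ] (𝟙 (coprime? (suc k)) * (+ suc k) ^ suc m)) (𝟙-no (coprime? 0) gcd[0,n]≢1) ⟨
      𝟙 (coprime? 0) * (+ 0) ^ suc m + ∑[ k < suc m ] (𝟙 (coprime? (suc k)) * (+ suc k) ^ suc m)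
        ≡⟨ ∑-unfoldˡ (suc m) (λ k → 𝟙 (coprime? k) * (+ k) ^ suc m) ⟨
      coprimePowerSum n (suc m) ∎
      where open ≡-Reasoning

    φ≡coprimeCount : + φ n ≡ coprimeCount n
    φ≡coprimeCount = begin
      + length (filter coprime? (map suc (upTo n)))
        ≡⟨ cong (λ ks → + length (filter coprime? ks)) (map-upTo suc n) ⟩
      + length (filter coprime? (applyUpTo suc n))
        ≡⟨ length-filter coprime? n suc ⟩
      ∑[ k < n ] 𝟙 (coprime? (suc k))
        ≡⟨ ℤ.+-identityˡ _ ⟨
      0ℤ + ∑[ k < n ] 𝟙 (coprime? (suc k))
        ≡⟨ cong (_+ ∑[ k < n ] 𝟙 (coprime? (suc k))) (𝟙-no (coprime? 0) gcd[0,n]≢1) ⟨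
      𝟙 (coprime? 0) + ∑[ k < n ] 𝟙 (coprime? (suc k))
        ≡⟨ ∑-unfoldˡ n (λ k → 𝟙 (coprime? k)) ⟨
      coprimeCount n + 𝟙 (coprime? n)
        ≡⟨ cong (λ c → coprimeCount n + c) (𝟙-no (coprime? n) gcd[n,n]≢1) ⟩
      coprimeCount n + 0ℤ
        ≡⟨ ℤ.+-identityʳ _ ⟩
      coprimeCount n ∎
      where open ≡-Reasoning

  weakCarmichael⇔ : ∀ {n} → 2 ℕ.≤ n → WeakCarmichael n ⇔ (Composite n × + n ∣ coprimePowerSum n (n ℕ.∸ 1) - coprimeCount n)
  weakCarmichael⇔ {suc (suc m)} (s≤s (s≤s z≤n)) = mk⇔
    (λ (composite-n , congruent) → composite-n , subst₂ (λ a b → + n ∣ a - b) (sum-coprimesUpTo m) (φ≡coprimeCount m) (∣ᵤ⇒∣ congruent))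
    (λ (composite-n , n∣) → composite-n , ∣⇒∣ᵤ (subst₂ (λ a b → + n ∣ a - b) (sym (sum-coprimesUpTo m)) (sym (φ≡coprimeCount m)) n∣))
    where n : ℕ
          n = suc (suc m)

open WeakCarmichaelAsDivisibility

module TwoOddPrimePowers {p q} (p-prime : Prime p) (q-prime : Prime q) (p≢q : p ≢ q)
                         (p-odd : ¬ (2 ℕ.∣ p)) (q-odd : ¬ (2 ℕ.∣ q)) (e f : ℕ) where
  open import Data.Integer using (_-_; _*_; _^_)
  open import Data.Integer.Divisibility.Signed using (_∣_; ∣ᵤ⇒∣; ∣⇒∣ᵤ)
  open import Data.Nat.Coprimality using (Coprime) renaming (sym to coprime-sym)
  open import Data.Nat.Divisibility.Core using (hasNonTrivialDivisor)
  open import Data.Nat.Primality using (Composite; prime⇒nonTrivial)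
  open import Function.Properties.Equivalence using () renaming (trans to ⇔-trans)
  open import Data.Product.Function.NonDependent.Propositional using (_×-⇔_)
  open TwoPrimePowers p-prime q-prime p≢q e f using (n; p∣n)

  private
    instance
      p≢0 : ℕ.NonZero p
      p≢0 = prime⇒nonZero p-prime
      q≢0 : ℕ.NonZero q
      q≢0 = prime⇒nonZero q-prime
      pᵉ≢0 : ℕ.NonZero (p ℕ.^ e)
      pᵉ≢0 = ℕ.m^n≢0 p e
      qᶠ≢0 : ℕ.NonZero (q ℕ.^ f)
      qᶠ≢0 = ℕ.m^n≢0 q f
      pᵉ⁺¹≢0 : ℕ.NonZero (p ℕ.^ suc e)
      pᵉ⁺¹≢0 = ℕ.m^n≢0 p (suc e)
      qᶠ⁺¹≢0 : ℕ.NonZero (q ℕ.^ suc f)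
      qᶠ⁺¹≢0 = ℕ.m^n≢0 q (suc f)
    -- n - 1 = suc t: the power sum lemmas are stated for successor exponents.
    t : ℕ
    t = n ℕ.∸ 2
    D : ℕ → ℤ
    D m = coprimePowerSum m (suc t) - coprimeCount m

  p<n : p ℕ.< n
  p<n = ℕ.<-≤-trans (ℕ.m<m*n p q (ℕ.nonTrivial⇒n>1 q {{prime⇒nonTrivial q-prime}}))
                    (ℕ.*-mono-≤ (ℕ.m≤m*n p (p ℕ.^ e)) (ℕ.m≤m*n q (q ℕ.^ f)))

  2≤n : 2 ℕ.≤ n
  2≤n = ℕ.≤-trans (ℕ.nonTrivial⇒n>1 p {{prime⇒nonTrivial p-prime}}) (ℕ.<⇒≤ p<n)

  n∸1≡1+t : n ℕ.∸ 1 ≡ suc t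
  n∸1≡1+t = ℕ.+-∸-assoc 1 2≤n

  composite : Composite n
  composite = hasNonTrivialDivisor {{prime⇒nonTrivial p-prime}} p<n p∣n

  e≤t : e ℕ.≤ t
  e≤t = ℕ.∸-monoˡ-≤ 2 (ℕ.≤-trans (n<m^n (ℕ.nonTrivial⇒n>1 p {{prime⇒nonTrivial p-prime}}) (suc e))
                                 (ℕ.m≤m*n (p ℕ.^ suc e) (q ℕ.^ suc f)))

  f≤t : f ℕ.≤ t
  f≤t = ℕ.∸-monoˡ-≤ 2 (ℕ.≤-trans (n<m^n (ℕ.nonTrivial⇒n>1 q {{prime⇒nonTrivial q-prime}}) (suc f))
                                 (ℕ.m≤n*m (q ℕ.^ suc f) (p ℕ.^ suc e)))

  n∣⇔ : ∀ {x} → (+ n ∣ x) ⇔ ((+ p) ^ suc e ∣ x × (+ q) ^ suc f ∣ x)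
  n∣⇔ {x} = mk⇔
    (λ n∣x → ℤ.∣-trans pᴱ∣n n∣x , ℤ.∣-trans qᶠ∣n n∣x)
    (λ (pᴱ∣x , qᶠ∣x) → ∣ᵤ⇒∣ {+ n} {x} (coprime⇒∣-* coprime-pᴱ-qᶠ (unsigned (pos-^ p (suc e)) pᴱ∣x) (unsigned (pos-^ q (suc f)) qᶠ∣x)))
    where
    +n≡pᴱqᶠ : + n ≡ (+ p) ^ suc e * (+ q) ^ suc f
    +n≡pᴱqᶠ = pos-^*^ p (suc e) q (suc f)
    pᴱ∣n : (+ p) ^ suc e ∣ + n
    pᴱ∣n = ℤ.divides ((+ q) ^ suc f) (trans +n≡pᴱqᶠ (ℤ.*-comm ((+ p) ^ suc e) ((+ q) ^ suc f)))
    qᶠ∣n : (+ q) ^ suc f ∣ + n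
    qᶠ∣n = ℤ.divides ((+ p) ^ suc e) +n≡pᴱqᶠ
    unsigned : ∀ {m y} → + m ≡ y → y ∣ x → m ℕ.∣ ℤ.∣ x ∣
    unsigned {m} refl m∣x = ∣⇒∣ᵤ {+ m} m∣x
    coprime-pᴱ-qᶠ : Coprime (p ℕ.^ suc e) (q ℕ.^ suc f)
    coprime-pᴱ-qᶠ = coprime-sym (coprime-^ (coprime-sym (coprime-^ coprime-p-q (suc f))) (suc e))
      where coprime-p-q : Coprime p q
            coprime-p-q = ∤⇒coprime q-prime (distinct-primes-∤ q-prime p-prime (≢-sym p≢q))

  p-side : ((+ p) ^ suc e ∣ D n) ⇔ (p ℕ.∣ q ℕ.∸ 1 ⊎ (p ℕ.∸ 1) ℕ.∣ suc t)
  p-side = ⇔-trans (ModuloPrimePower.p^[e+1]∣⇔p∣Δ p-prime q-prime p≢q e f t e≤t p-odd)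
                   (p∣Δ⇔ p-prime q-prime p≢q (s≤s z≤n))

  q-side : ((+ q) ^ suc f ∣ D n) ⇔ (q ℕ.∣ p ℕ.∸ 1 ⊎ (q ℕ.∸ 1) ℕ.∣ suc t)
  q-side = subst (λ m → ((+ q) ^ suc f ∣ D m) ⇔ (q ℕ.∣ p ℕ.∸ 1 ⊎ (q ℕ.∸ 1) ℕ.∣ suc t))
                 (ℕ.*-comm (q ℕ.^ suc f) (p ℕ.^ suc e))
                 (⇔-trans (ModuloPrimePower.p^[e+1]∣⇔p∣Δ q-prime p-prime (≢-sym p≢q) f e t f≤t q-odd)
                          (p∣Δ⇔ q-prime p-prime (≢-sym p≢q) (s≤s z≤n)))

  weakCarmichael⇔criteria :
    WeakCarmichael n ⇔ ((p ℕ.∣ q ℕ.∸ 1 ⊎ (p ℕ.∸ 1) ℕ.∣ n ℕ.∸ 1) × (q ℕ.∣ p ℕ.∸ 1 ⊎ (q ℕ.∸ 1) ℕ.∣ n ℕ.∸ 1))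
  weakCarmichael⇔criteria = ⇔-trans (weakCarmichael⇔ 2≤n) (subst Characterisation (sym n∸1≡1+t)
    (⇔-trans (mk⇔ proj₂ (composite ,_)) (⇔-trans n∣⇔ (p-side ×-⇔ q-side))))
    where Characterisation : ℕ → Set
          Characterisation s = (Composite n × + n ∣ coprimePowerSum n s - coprimeCount n)
                       ⇔ ((p ℕ.∣ q ℕ.∸ 1 ⊎ (p ℕ.∸ 1) ℕ.∣ s) × (q ℕ.∣ p ℕ.∸ 1 ⊎ (q ℕ.∸ 1) ℕ.∣ s))

module DivisorTransfer where
  open import Data.Integer using (_*_; _^_)

  ^-≈1-transfer : ∀ {m} a b E F d l → a ≈ 1ℤ [mod m ] →
    a ^ E * b ^ F ≈ 1ℤ [mod m ] → a ^ (d ℕ.* E) * b ^ (l ℕ.* F) ≈ 1ℤ [mod m ]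
  ^-≈1-transfer {m} a b E F d l a≈1 aᴱbᶠ≈1 = begin
    a ^ (d ℕ.* E) * b ^ (l ℕ.* F)        ≈⟨ *-cong (power≈1 a≈1 (d ℕ.* E)) (≈-reflexive (cong (b ^_) (ℕ.*-comm l F))) ⟩
    1ℤ * b ^ (F ℕ.* l)                   ≡⟨ ℤ.*-identityˡ _ ⟩
    b ^ (F ℕ.* l)                        ≡⟨ ℤ.^-*-assoc b F l ⟨
    (b ^ F) ^ l                          ≈⟨ power≈1 bᶠ≈1 l ⟩
    1ℤ                                   ∎
    where
    open ≈-Reasoning m
    power≈1 : ∀ {x} → x ≈ 1ℤ [mod m ] → ∀ k → x ^ k ≈ 1ℤ [mod m ]
    power≈1 x≈1 k = ≈-trans (^-cong k x≈1) (≈-reflexive (ℤ.^-zeroˡ k))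
    bᶠ≈1 : b ^ F ≈ 1ℤ [mod m ]
    bᶠ≈1 = begin
      b ^ F              ≡⟨ ℤ.*-identityˡ (b ^ F) ⟨
      1ℤ * b ^ F         ≈⟨ *-cong (power≈1 a≈1 E) (≈-refl {b ^ F}) ⟨
      a ^ E * b ^ F      ≈⟨ aᴱbᶠ≈1 ⟩
      1ℤ                 ∎

  ∣∸1-transfer : ∀ {m a b} .{{_ : ℕ.NonZero a}} .{{_ : ℕ.NonZero b}} E F d l → m ℕ.∣ a ℕ.∸ 1 →
    m ℕ.∣ a ℕ.^ E ℕ.* b ℕ.^ F ℕ.∸ 1 → m ℕ.∣ a ℕ.^ (d ℕ.* E) ℕ.* b ℕ.^ (l ℕ.* F) ℕ.∸ 1
  ∣∸1-transfer {m} {a} {b} E F d l m∣a-1 m∣aᴱbᶠ-1 =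
    ≈1⇒∣∸1 (positive (d ℕ.* E) (l ℕ.* F)) (subst (_≈ 1ℤ [mod + m ]) (sym (pos-^*^ a (d ℕ.* E) b (l ℕ.* F)))
      (^-≈1-transfer (+ a) (+ b) E F d l (∣∸1⇒≈1 (ℕ.>-nonZero⁻¹ a) m∣a-1)
        (subst (_≈ 1ℤ [mod + m ]) (pos-^*^ a E b F) (∣∸1⇒≈1 (positive E F) m∣aᴱbᶠ-1))))
    where positive : ∀ i j → 1 ℕ.≤ a ℕ.^ i ℕ.* b ℕ.^ j
          positive i j = ℕ.>-nonZero⁻¹ _ {{ℕ.m*n≢0 _ _ {{ℕ.m^n≢0 a i}} {{ℕ.m^n≢0 b j}}}}

open DivisorTransfer

open import Data.Nat using (_*_; _^_; NonZero)
open import Data.Nat.Divisibility using (_∣_)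

corollary2p37 : (p q e f : ℕ) → Prime p → Prime q → ¬ (2 ∣ p) → ¬ (2 ∣ q) → ¬ (p ≡ q) →
    NonZero e → NonZero f → WeakCarmichael (p ^ e * q ^ f) →
    (d l : ℕ) → NonZero d → NonZero l → WeakCarmichael (p ^ (d * e) * q ^ (l * f))
corollary2p37 p q (suc e) (suc f) p-prime q-prime p-odd q-odd p≢q _ _ wc (suc d) (suc l) _ _ =
  Equivalence.from (criteria (e ℕ.+ d * suc e) (f ℕ.+ l * suc f))
    (Product.map (Sum.map₂ transfer-p) (Sum.map₂ transfer-q) (Equivalence.to (criteria e f) wc))
  where
  instance
    p≢0 : NonZero p
    p≢0 = prime⇒nonZero p-prime
    q≢0 : NonZero q
    q≢0 = prime⇒nonZero q-prime
  criteria : ∀ e f → WeakCarmichael (p ^ suc e * q ^ suc f)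
    ⇔ ((p ∣ q ℕ.∸ 1 ⊎ p ℕ.∸ 1 ∣ p ^ suc e * q ^ suc f ℕ.∸ 1) × (q ∣ p ℕ.∸ 1 ⊎ q ℕ.∸ 1 ∣ p ^ suc e * q ^ suc f ℕ.∸ 1))
  criteria = TwoOddPrimePowers.weakCarmichael⇔criteria p-prime q-prime p≢q p-odd q-odd
  transfer-p : p ℕ.∸ 1 ∣ p ^ suc e * q ^ suc f ℕ.∸ 1 → p ℕ.∸ 1 ∣ p ^ (suc d * suc e) * q ^ (suc l * suc f) ℕ.∸ 1
  transfer-p = ∣∸1-transfer (suc e) (suc f) (suc d) (suc l) ℕ.∣-refl
  transfer-q : q ℕ.∸ 1 ∣ p ^ suc e * q ^ suc f ℕ.∸ 1 → q ℕ.∸ 1 ∣ p ^ (suc d * suc e) * q ^ (suc l * suc f) ℕ.∸ 1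
  transfer-q q-1∣n-1 = subst (λ N → q ℕ.∸ 1 ∣ N ℕ.∸ 1) (ℕ.*-comm (q ^ (suc l * suc f)) (p ^ (suc d * suc e)))
    (∣∸1-transfer (suc f) (suc e) (suc l) (suc d) ℕ.∣-refl
      (subst (λ N → q ℕ.∸ 1 ∣ N ℕ.∸ 1) (ℕ.*-comm (p ^ suc e) (q ^ suc f)) q-1∣n-1))
corollary2p37 _ _ zero    _       _ _ _ _ _ () _  _ _       _       _  _
corollary2p37 _ _ (suc _) zero    _ _ _ _ _ _  () _ _       _       _  _
corollary2p37 _ _ (suc _) (suc _) _ _ _ _ _ _  _  _ zero    _       () _
corollary2p37 _ _ (suc _) (suc _) _ _ _ _ _ _  _  _ (suc _) zero    _  ()
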